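{- For all integers $m\geq 0$ and $n\geq 0$, $$\overline a_{2m+2}(8n+z)\equiv 0\pmod 8\quad\text{for } z\in\{5,7\}.$$
   Context: For $|q|<1$ and a positive integer $h$, write $f_h=(q^h;q^h)_\infty=\prod_{k\geq 1}(1-q^{hk})$. For a positive integer $c$, the generalized overcubic partition function $\overline a_c(n)$ is defined by the generating function $\sum_{n\geq 0}\overline a_c(n)q^n=\dfrac{f_4^{c-1}}{f_1^2f_2^{2c-3}}$. -}

module Defs where

open import Data.Nat as ℕ using (ℕ; zero; suc)
open import Data.Integer as ℤ using (ℤ; +_; -[1+_])
open import Data.List using (List; []; _∷_; _++_; replicate)
open import Data.List.Base using (applyUpTo)

-- Formal power series over ℤ truncated modulo q^(N+1), represented as the
-- list of their first N+1 coefficients [a₀, a₁, …, a_N].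

coeff : List ℤ → ℕ → ℤ
coeff []       _       = + 0
coeff (a ∷ _)  zero    = a
coeff (_ ∷ as) (suc n) = coeff as n

trunc : ℕ → List ℤ → List ℤ
trunc N f = applyUpTo (coeff f) (suc N)

convCoeff : List ℤ → List ℤ → ℕ → ℤ
convCoeff f g n = go n n
  where
  go : ℕ → ℕ → ℤ
  go zero    n = coeff f 0 ℤ.* coeff g n
  go (suc k) n = go k n ℤ.+ coeff f (suc k) ℤ.* coeff g (n ℕ.∸ suc k)

mul : ℕ → List ℤ → List ℤ → List ℤ
mul N f g = applyUpTo (convCoeff f g) (suc N)

one : ℕ → List ℤ
one N = trunc N (+ 1 ∷ [])

oneMinusQ^ : ℕ → ℕ → List ℤ
oneMinusQ^ N j = trunc N (+ 1 ∷ replicate (ℕ.pred j) (+ 0) ++ (ℤ.- (+ 1) ∷ []))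

-- f_h = ∏_{k≥1} (1 - q^{hk}) truncated mod q^(N+1), for h ≥ 1.
-- Factors with hk > N are ≡ 1 mod q^(N+1), so k = 1..N suffices.
fTrunc : ℕ → ℕ → List ℤ
fTrunc N h = go N
  where
  go : ℕ → List ℤ
  go zero    = one N
  go (suc k) = mul N (oneMinusQ^ N (h ℕ.* suc k)) (go k)

-- inverse of a series with constant term 1, truncated mod q^(N+1):
-- b_0 = 1, b_{n+1} = - Σ_{k=0}^{n} a_{n+1-k} b_k.
invList : List ℤ → ℕ → List ℤ
invList f zero    = + 1 ∷ []
invList f (suc n) = prev ++ (ℤ.- go n ∷ [])
  where
  prev = invList f n
  go : ℕ → ℤ
  go zero    = coeff f (suc n) ℤ.* coeff prev 0
  go (suc k) = go k ℤ.+ coeff f (suc n ℕ.∸ suc k) ℤ.* coeff prev (suc k)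

inv : ℕ → List ℤ → List ℤ
inv N f = invList f N

powN : ℕ → List ℤ → ℕ → List ℤ
powN N f zero    = one N
powN N f (suc e) = mul N f (powN N f e)

powZ : ℕ → List ℤ → ℤ → List ℤ
powZ N f (+ e)      = powN N f e
powZ N f -[1+ e ]   = inv N (powN N f (suc e))

-- Σ ā_c(n) q^n = f_4^{c-1} / (f_1^2 f_2^{2c-3}), truncated mod q^(N+1)
overcubicSeries : ℕ → ℕ → List ℤ
overcubicSeries c N =
  mul N (powZ N (fTrunc N 4) (+ c ℤ.- + 1))
        (inv N (mul N (powN N (fTrunc N 1) 2)
                      (powZ N (fTrunc N 2) (+ (2 ℕ.* c) ℤ.- + 3))))

abar : ℕ → ℕ → ℤ
abar c n = coeff (overcubicSeries c n) n

{-# OPTIONS --safe #-}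
-- By Gauss, f₁²/f₂ = φ(-q) and f₂²/f₄ = φ(-q²) with φ(q) = Σ_{k ∈ ℤ} q^{k²}, so the generating
-- function of ā_{2m+2} is 1/(φ(-q) φ(-q²)^{2m+1}). Write φ(-q) = E + 2O, where E collects the
-- terms with k even (exponents ≡ 0, 4 mod 8) and O those with k odd (exponents ≡ 1 mod 8);
-- the exponents of φ(-q²) are ≡ 0, 2 mod 8. Since 1/φ(-q) = (E - 2O)/(E² - 4O²), the series is
-- E·W - 2·O·W with W = 1/(φ(-q²)^{2m+1} (E² - 4O²)), a series in even exponents, so E·W has no odd
-- exponents. As E ≡ φ(-q²) ≡ 1 (mod 2), their squares are ≡ 1 (mod 4); hence W ≡ φ(-q²) (mod 4)
-- and O·W ≡ O·φ(-q²) (mod 4), whose exponents are ≡ 1, 3 (mod 8). At exponents ≡ 5, 7 (mod 8)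
-- both parts therefore vanish modulo 8.
--
-- Gauss's identity is proved in the finite form Σ_{|k| ≤ n} (-1)^k x^{k²} [2n, n - k]_{x²} = (x; x²)ₙ²,
-- by a three-term recurrence in n for the summands, and all series are compared modulo q^{N+1}.
module Submission where

open import Data.Nat using (ℕ)

module PowerSeries where

  open import Data.Nat as ℕ using (ℕ; zero; suc; _∸_; _≤_; _<_; _≡ᵇ_; z≤n; s≤s)
  import Data.Nat.Properties as ℕP
  open import Data.Integer as ℤ using (ℤ; +_; _+_; _*_; -_)
  import Data.Integer.Properties as ℤP
  open import Data.Integer.Tactic.RingSolver using (solve-∀)
  open import Data.Bool using (if_then_else_)
  open import Data.List using (List; []; _∷_; _++_; length)
  import Data.List.Properties as Listₚ
  open import Data.Maybe using (Maybe; just; nothing)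
  open import Data.Product using (_×_; _,_; proj₁)
  open import Data.Sum using (inj₁; inj₂)
  open import Relation.Nullary using (yes; no)
  open import Relation.Binary.PropositionalEquality hiding ([_])
  open import Relation.Binary.Structures using (IsEquivalence)
  import Relation.Binary.Reasoning.Setoid as SetoidReasoning
  open import Algebra.Bundles using (CommutativeRing)
  import Algebra.Solver.Ring as RingSolver
  import Algebra.Solver.Ring.AlmostCommutativeRing as ACR
  open import Level using (0ℓ)
  open import Defs using (coeff)

  Series : Set
  Series = ℕ → ℤ

  infix 4 _≈_
  _≈_ : Series → Series → Set
  f ≈ g = ∀ n → f n ≡ g n

  ≈-refl : ∀ {f} → f ≈ f
  ≈-refl _ = refl

  ≈-sym : ∀ {f g} → f ≈ g → g ≈ f
  ≈-sym p n = sym (p n)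

  ≈-trans : ∀ {f g h} → f ≈ g → g ≈ h → f ≈ h
  ≈-trans p q n = trans (p n) (q n)

  ≈-isEquivalence : IsEquivalence _≈_
  ≈-isEquivalence = record { refl = ≈-refl ; sym = ≈-sym ; trans = ≈-trans }

  [_] : ℤ → Series
  [ c ] zero    = c
  [ c ] (suc _) = + 0

  0ₛ 1ₛ : Series
  0ₛ _ = + 0
  1ₛ = [ + 1 ]

  infixl 6 _⊕_ _⊖_
  infixl 7 _⊛_
  infix  8 ⊝_

  _⊕_ : Series → Series → Series
  (f ⊕ g) n = f n + g n

  ⊝_ : Series → Series
  (⊝ f) n = - f n

  _⊖_ : Series → Series → Series
  f ⊖ g = f ⊕ ⊝ g

  tail : Series → Series
  tail f n = f (suc n)

  _⊛_ : Series → Series → Series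
  (f ⊛ g) zero    = f 0 * g 0
  (f ⊛ g) (suc n) = f 0 * g (suc n) + (tail f ⊛ g) n

  ⊕-cong : ∀ {f f′ g g′} → f ≈ f′ → g ≈ g′ → f ⊕ g ≈ f′ ⊕ g′
  ⊕-cong p q n = cong₂ _+_ (p n) (q n)

  ⊝-cong : ∀ {f f′} → f ≈ f′ → ⊝ f ≈ ⊝ f′
  ⊝-cong p n = cong -_ (p n)

  ⊛-cong : ∀ {f f′ g g′} → f ≈ f′ → g ≈ g′ → f ⊛ g ≈ f′ ⊛ g′
  ⊛-cong p q zero    = cong₂ _*_ (p 0) (q 0)
  ⊛-cong p q (suc n) = cong₂ _+_ (cong₂ _*_ (p 0) (q (suc n))) (⊛-cong (λ k → p (suc k)) q n)

  ⊕-congˡ : ∀ f {g g′} → g ≈ g′ → f ⊕ g ≈ f ⊕ g′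
  ⊕-congˡ f = ⊕-cong (≈-refl {f})

  ⊕-congʳ : ∀ {f f′} g → f ≈ f′ → f ⊕ g ≈ f′ ⊕ g
  ⊕-congʳ g p = ⊕-cong p (≈-refl {g})

  ⊛-congˡ : ∀ f {g g′} → g ≈ g′ → f ⊛ g ≈ f ⊛ g′
  ⊛-congˡ f = ⊛-cong (≈-refl {f})

  ⊛-congʳ : ∀ {f f′} g → f ≈ f′ → f ⊛ g ≈ f′ ⊛ g
  ⊛-congʳ g p = ⊛-cong p (≈-refl {g})

  ⊕-identityʳ : ∀ f {z} → z ≈ 0ₛ → f ⊕ z ≈ f
  ⊕-identityʳ f z≈0 n = trans (cong (_+_ (f n)) (z≈0 n)) (ℤP.+-identityʳ (f n))

  ⊛-zeroˡ : ∀ {f} g → f ≈ 0ₛ → f ⊛ g ≈ 0ₛ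
  ⊛-zeroˡ g p zero    = cong (_* g 0) (p 0)
  ⊛-zeroˡ g p (suc n) = cong₂ _+_ (cong (_* g (suc n)) (p 0)) (⊛-zeroˡ g (λ k → p (suc k)) n)

  ⊛-identityˡ : ∀ g → 1ₛ ⊛ g ≈ g
  ⊛-identityˡ g zero    = ℤP.*-identityˡ (g 0)
  ⊛-identityˡ g (suc n) =
    trans (cong₂ _+_ (ℤP.*-identityˡ (g (suc n))) (⊛-zeroˡ g ≈-refl n)) (ℤP.+-identityʳ _)

  ⊛-distribʳ : ∀ g f h → (f ⊕ h) ⊛ g ≈ f ⊛ g ⊕ h ⊛ g
  ⊛-distribʳ g f h zero    = ℤP.*-distribʳ-+ (g 0) (f 0) (h 0)
  ⊛-distribʳ g f h (suc n) =
    trans (cong (_+_ ((f 0 + h 0) * g (suc n))) (⊛-distribʳ g (tail f) (tail h) n))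
          (shuffle (f 0) (h 0) (g (suc n)) _ _)
    where
    shuffle : ∀ a b c d e → (a + b) * c + (d + e) ≡ (a * c + d) + (b * c + e)
    shuffle = solve-∀

  ⊛-distribˡ : ∀ f g h → f ⊛ (g ⊕ h) ≈ f ⊛ g ⊕ f ⊛ h
  ⊛-distribˡ f g h zero    = ℤP.*-distribˡ-+ (f 0) (g 0) (h 0)
  ⊛-distribˡ f g h (suc n) =
    trans (cong (_+_ (f 0 * (g (suc n) + h (suc n)))) (⊛-distribˡ (tail f) g h n))
          (shuffle (f 0) (g (suc n)) (h (suc n)) _ _)
    where
    shuffle : ∀ a b c d e → a * (b + c) + (d + e) ≡ (a * b + d) + (a * c + e)
    shuffle = solve-∀

  -- Peeling off the leading coefficients of both factors reduces
  -- commutativity at degree n + 2 to commutativity at degree n.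
  private
    ⊛-comm-at : ∀ n → (∀ f g → (f ⊛ g) n ≡ (g ⊛ f) n)
                    × (∀ f g → (f ⊛ g) (suc n) ≡ (g ⊛ f) (suc n))
    ⊛-comm-at zero = (λ f g → ℤP.*-comm (f 0) (g 0))
                   , (λ f g → swap (f 0) (g 1) (f 1) (g 0))
      where
      swap : ∀ a b c d → a * b + c * d ≡ d * c + b * a
      swap = solve-∀
    ⊛-comm-at (suc n) with ⊛-comm-at n
    ... | (ih , ih-suc) = ih-suc , λ f g → begin
      f 0 * g m + (tail f ⊛ g) (suc n)                     ≡⟨ cong (_+_ (f 0 * g m)) (ih-suc (tail f) g) ⟩
      f 0 * g m + (g 0 * f m + (tail g ⊛ tail f) n)        ≡⟨ cong (λ t → f 0 * g m + (g 0 * f m + t)) (ih (tail g) (tail f)) ⟩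
      f 0 * g m + (g 0 * f m + (tail f ⊛ tail g) n)        ≡⟨ exchange (f 0 * g m) (g 0 * f m) _ ⟩
      g 0 * f m + (f 0 * g m + (tail f ⊛ tail g) n)        ≡⟨ cong (_+_ (g 0 * f m)) (ih-suc (tail g) f) ⟨
      g 0 * f m + (tail g ⊛ f) (suc n)                     ∎
      where
      open ≡-Reasoning
      m : ℕ
      m = suc (suc n)
      exchange : ∀ a b c → a + (b + c) ≡ b + (a + c)
      exchange = solve-∀

  ⊛-comm : ∀ f g → f ⊛ g ≈ g ⊛ f
  ⊛-comm f g n = proj₁ (⊛-comm-at n) f g

  ⊛-identityʳ : ∀ g → g ⊛ 1ₛ ≈ g
  ⊛-identityʳ g = ≈-trans (⊛-comm g 1ₛ) (⊛-identityˡ g)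

  ⊛-zeroʳ : ∀ f {g} → g ≈ 0ₛ → f ⊛ g ≈ 0ₛ
  ⊛-zeroʳ f {g} p = ≈-trans (⊛-comm f g) (⊛-zeroˡ f p)

  ⊛-assoc : ∀ f g h → (f ⊛ g) ⊛ h ≈ f ⊛ (g ⊛ h)
  ⊛-assoc f g h zero    = ℤP.*-assoc (f 0) (g 0) (h 0)
  ⊛-assoc f g h (suc n) = begin
    f 0 * g 0 * h (suc n) + ((f 0 · tail g ⊕ tail f ⊛ g) ⊛ h) n
      ≡⟨ cong (_+_ (f 0 * g 0 * h (suc n))) (⊛-distribʳ h (f 0 · tail g) (tail f ⊛ g) n) ⟩
    f 0 * g 0 * h (suc n) + (((f 0 · tail g) ⊛ h) n + ((tail f ⊛ g) ⊛ h) n)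
      ≡⟨ cong₂ (λ x y → f 0 * g 0 * h (suc n) + (x + y)) (·-⊛ (f 0) (tail g) n) (⊛-assoc (tail f) g h n) ⟩
    f 0 * g 0 * h (suc n) + (f 0 * (tail g ⊛ h) n + (tail f ⊛ (g ⊛ h)) n)
      ≡⟨ regroup (f 0) (g 0) (h (suc n)) _ _ ⟩
    f 0 * (g 0 * h (suc n) + (tail g ⊛ h) n) + (tail f ⊛ (g ⊛ h)) n
      ∎
    where
    open ≡-Reasoning
    infixl 7 _·_
    _·_ : ℤ → Series → Series
    (c · u) k = c * u k
    ·-⊛ : ∀ c u k → ((c · u) ⊛ h) k ≡ c * (u ⊛ h) k
    ·-⊛ c u zero    = ℤP.*-assoc c (u 0) (h 0)
    ·-⊛ c u (suc k) = trans (cong (_+_ (c * u 0 * h (suc k))) (·-⊛ c (tail u) k))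
                            (factor c (u 0) (h (suc k)) _)
      where
      factor : ∀ c a b d → c * a * b + c * d ≡ c * (a * b + d)
      factor = solve-∀
    regroup : ∀ a b c x y → a * b * c + (a * x + y) ≡ a * (b * c + x) + y
    regroup = solve-∀

  seriesRing : CommutativeRing 0ℓ 0ℓ
  seriesRing = record
    { Carrier = Series ; _≈_ = _≈_ ; _+_ = _⊕_ ; _*_ = _⊛_ ; -_ = ⊝_ ; 0# = 0ₛ ; 1# = 1ₛ
    ; isCommutativeRing = record
      { isRing = record
        { +-isAbelianGroup = record
          { isGroup = record
            { isMonoid = record
              { isSemigroup = record
                { isMagma = record { isEquivalence = ≈-isEquivalence ; ∙-cong = ⊕-cong }
                ; assoc = λ f g h n → ℤP.+-assoc (f n) (g n) (h n) }
              ; identity = (λ f n → ℤP.+-identityˡ (f n)) , (λ f n → ℤP.+-identityʳ (f n)) }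
            ; inverse = (λ f n → ℤP.+-inverseˡ (f n)) , (λ f n → ℤP.+-inverseʳ (f n))
            ; ⁻¹-cong = ⊝-cong }
          ; comm = λ f g n → ℤP.+-comm (f n) (g n) }
        ; *-cong = ⊛-cong
        ; *-assoc = ⊛-assoc
        ; *-identity = ⊛-identityˡ , ⊛-identityʳ
        ; distrib = ⊛-distribˡ , λ g f h → ⊛-distribʳ g f h }
      ; *-comm = ⊛-comm } }

  module ≈-Reasoning = SetoidReasoning (CommutativeRing.setoid seriesRing)

  [_]-⊛ : ∀ a b → [ a * b ] ≈ [ a ] ⊛ [ b ]
  [ a ]-⊛ b zero    = refl
  [ a ]-⊛ b (suc n) = sym (cong₂ _+_ (ℤP.*-zeroʳ a) (⊛-zeroˡ [ b ] ≈-refl n))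

  [_]-⊛-coeff : ∀ c g n → ([ c ] ⊛ g) n ≡ c * g n
  [ c ]-⊛-coeff g zero    = refl
  [ c ]-⊛-coeff g (suc n) = trans (cong (_+_ (c * g (suc n))) (⊛-zeroˡ g ≈-refl n)) (ℤP.+-identityʳ _)

  private
    constants : ℤ.+-*-rawRing ACR.-Raw-AlmostCommutative⟶ ACR.fromCommutativeRing seriesRing
    constants = record
      { ⟦_⟧    = [_]
      ; +-homo = λ { a b zero → refl ; a b (suc _) → refl }
      ; *-homo = [_]-⊛
      ; -‿homo = λ { a zero → refl ; a (suc _) → refl }
      ; 0-homo = λ { zero → refl ; (suc _) → refl }
      ; 1-homo = λ { zero → refl ; (suc _) → refl } }

    [_]≟_ : ∀ a b → Maybe ([ a ] ≈ [ b ])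
    [ a ]≟ b with a ℤP.≟ b
    ... | yes refl = just ≈-refl
    ... | no _     = nothing

  open RingSolver ℤ.+-*-rawRing (ACR.fromCommutativeRing seriesRing) constants [_]≟_ public
    using (solve; _:=_; con; _:+_; _:*_; :-_; _:-_)

  Σ≤ : ℕ → (ℕ → ℤ) → ℤ
  Σ≤ zero    h = h 0
  Σ≤ (suc k) h = Σ≤ k h + h (suc k)

  Σ≤-peel : ∀ k h → Σ≤ (suc k) h ≡ h 0 + Σ≤ k (λ i → h (suc i))
  Σ≤-peel zero    h = refl
  Σ≤-peel (suc k) h = trans (cong (_+ h (suc (suc k))) (Σ≤-peel k h)) (ℤP.+-assoc (h 0) _ _)

  Σ≤-cong : ∀ k {h g} → (∀ i → i ≤ k → h i ≡ g i) → Σ≤ k h ≡ Σ≤ k g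
  Σ≤-cong zero    p = p 0 z≤n
  Σ≤-cong (suc k) p = cong₂ _+_ (Σ≤-cong k (λ i i≤k → p i (ℕP.m≤n⇒m≤1+n i≤k))) (p (suc k) ℕP.≤-refl)

  ⊛-coeff : ∀ f g n → (f ⊛ g) n ≡ Σ≤ n (λ i → f i * g (n ∸ i))
  ⊛-coeff f g zero    = refl
  ⊛-coeff f g (suc n) =
    sym (trans (Σ≤-peel n (λ i → f i * g (suc n ∸ i))) (cong (_+_ (f 0 * g (suc n))) (sym (⊛-coeff (tail f) g n))))

  q^_ : ℕ → Series
  (q^ e) n = if n ≡ᵇ e then + 1 else + 0

  q^-cong : ∀ {i j} → i ≡ j → q^ i ≈ q^ j
  q^-cong refl = ≈-refl

  q^0 : q^ 0 ≈ 1ₛ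
  q^0 zero    = refl
  q^0 (suc n) = refl

  q^-+ : ∀ i j → q^ i ⊛ q^ j ≈ q^ (i ℕ.+ j)
  q^-+ zero    j = ≈-trans (⊛-congʳ (q^ j) q^0) (⊛-identityˡ (q^ j))
  q^-+ (suc i) j zero    = refl
  q^-+ (suc i) j (suc n) = trans (ℤP.+-identityˡ _) (q^-+ i j n)

  infixr 8 _^_
  _^_ : Series → ℕ → Series
  f ^ zero  = 1ₛ
  f ^ suc e = f ⊛ f ^ e

  ^-+ : ∀ f a b → f ^ (a ℕ.+ b) ≈ f ^ a ⊛ f ^ b
  ^-+ f zero    b = ≈-sym (⊛-identityˡ (f ^ b))
  ^-+ f (suc a) b = ≈-trans (⊛-congˡ f (^-+ f a b)) (≈-sym (⊛-assoc f (f ^ a) (f ^ b)))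

  ^-⊛ : ∀ f g e → (f ⊛ g) ^ e ≈ f ^ e ⊛ g ^ e
  ^-⊛ f g zero    = ≈-sym (⊛-identityˡ 1ₛ)
  ^-⊛ f g (suc e) = ≈-trans (⊛-congˡ (f ⊛ g) (^-⊛ f g e)) (interchange f g (f ^ e) (g ^ e))
    where
    interchange : ∀ f g a b → (f ⊛ g) ⊛ (a ⊛ b) ≈ (f ⊛ a) ⊛ (g ⊛ b)
    interchange = solve 4 (λ f g a b → (f :* g) :* (a :* b) := (f :* a) :* (g :* b)) ≈-refl

  1ₛ^ : ∀ e → 1ₛ ^ e ≈ 1ₛ
  1ₛ^ zero    = ≈-refl
  1ₛ^ (suc e) = ≈-trans (⊛-identityˡ (1ₛ ^ e)) (1ₛ^ e)

  ^-unit : ∀ f e → f 0 ≡ + 1 → (f ^ e) 0 ≡ + 1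
  ^-unit f zero    p = refl
  ^-unit f (suc e) p = cong₂ _*_ p (^-unit f e p)

  sign : ℕ → Series
  sign zero    = 1ₛ
  sign (suc k) = ⊝ sign k

  Σˢ≤ : ℕ → (ℕ → Series) → Series
  Σˢ≤ zero    g = g 0
  Σˢ≤ (suc k) g = Σˢ≤ k g ⊕ g (suc k)

  Σˢ≤-peel : ∀ k g → Σˢ≤ (suc k) g ≈ g 0 ⊕ Σˢ≤ k (λ i → g (suc i))
  Σˢ≤-peel zero    g = ≈-refl
  Σˢ≤-peel (suc k) g n = trans (cong (_+ g (suc (suc k)) n) (Σˢ≤-peel k g n)) (ℤP.+-assoc (g 0 n) _ _)

  Σˢ≤-cong : ∀ k {g g′} → (∀ i → i ≤ k → g i ≈ g′ i) → Σˢ≤ k g ≈ Σˢ≤ k g′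
  Σˢ≤-cong zero    p = p 0 z≤n
  Σˢ≤-cong (suc k) p = ⊕-cong (Σˢ≤-cong k (λ i i≤k → p i (ℕP.m≤n⇒m≤1+n i≤k))) (p (suc k) ℕP.≤-refl)

  Σˢ≤-⊕ : ∀ k g g′ → Σˢ≤ k (λ i → g i ⊕ g′ i) ≈ Σˢ≤ k g ⊕ Σˢ≤ k g′
  Σˢ≤-⊕ zero    g g′ = ≈-refl
  Σˢ≤-⊕ (suc k) g g′ =
    ≈-trans (⊕-congʳ (g (suc k) ⊕ g′ (suc k)) (Σˢ≤-⊕ k g g′)) (interchange (Σˢ≤ k g) (Σˢ≤ k g′) (g (suc k)) (g′ (suc k)))
    where
    interchange : ∀ a b c d → (a ⊕ b) ⊕ (c ⊕ d) ≈ (a ⊕ c) ⊕ (b ⊕ d)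
    interchange = solve 4 (λ a b c d → (a :+ b) :+ (c :+ d) := (a :+ c) :+ (b :+ d)) ≈-refl

  Σˢ≤-⊛ : ∀ k g c → Σˢ≤ k (λ i → g i ⊛ c) ≈ Σˢ≤ k g ⊛ c
  Σˢ≤-⊛ zero    g c = ≈-refl
  Σˢ≤-⊛ (suc k) g c = ≈-trans (⊕-congʳ (g (suc k) ⊛ c) (Σˢ≤-⊛ k g c)) (≈-sym (⊛-distribʳ c (Σˢ≤ k g) (g (suc k))))

  inverseStep : Series → ℕ → List ℤ → ℕ → ℤ
  inverseStep a n bs zero    = a (suc n) * coeff bs 0
  inverseStep a n bs (suc k) = inverseStep a n bs k + a (suc n ∸ suc k) * coeff bs (suc k)

  inverseList : Series → ℕ → List ℤ
  inverseList a zero    = + 1 ∷ []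
  inverseList a (suc n) = inverseList a n ++ (- inverseStep a n (inverseList a n) n ∷ [])

  inverse : Series → Series
  inverse a n = coeff (inverseList a n) n

  coeff-++ˡ : ∀ xs ys {k} → k < length xs → coeff (xs ++ ys) k ≡ coeff xs k
  coeff-++ˡ (x ∷ xs) ys {zero}  _         = refl
  coeff-++ˡ (x ∷ xs) ys {suc k} (s≤s k<) = coeff-++ˡ xs ys k<

  coeff-++ʳ : ∀ xs ys → coeff (xs ++ ys) (length xs) ≡ coeff ys 0
  coeff-++ʳ []       ys = refl
  coeff-++ʳ (x ∷ xs) ys = coeff-++ʳ xs ys

  inverseList-length : ∀ a n → length (inverseList a n) ≡ suc n
  inverseList-length a zero    = refl
  inverseList-length a (suc n) =
    trans (Listₚ.length-++ (inverseList a n)) (trans (ℕP.+-comm _ 1) (cong suc (inverseList-length a n)))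

  inverseList-prefix : ∀ a {n k} → k ≤ n → coeff (inverseList a n) k ≡ inverse a k
  inverseList-prefix a {zero}  z≤n = refl
  inverseList-prefix a {suc n} k≤ with ℕP.m≤n⇒m<n∨m≡n k≤
  ... | inj₂ refl      = refl
  ... | inj₁ (s≤s k≤n) =
    trans (coeff-++ˡ (inverseList a n) _ (subst (_ <_) (sym (inverseList-length a n)) (s≤s k≤n)))
          (inverseList-prefix a k≤n)

  inverseStep-Σ : ∀ a n {k} → k ≤ n → inverseStep a n (inverseList a n) k ≡ Σ≤ k (λ i → a (suc n ∸ i) * inverse a i)
  inverseStep-Σ a n {zero}  _  = cong (a (suc n) *_) (inverseList-prefix a {n} z≤n)
  inverseStep-Σ a n {suc k} k< =
    cong₂ _+_ (inverseStep-Σ a n (ℕP.<⇒≤ k<)) (cong (a (suc n ∸ suc k) *_) (inverseList-prefix a k<))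

  inverse-suc : ∀ a n → inverse a (suc n) ≡ - Σ≤ n (λ i → a (suc n ∸ i) * inverse a i)
  inverse-suc a n = begin
    coeff (inverseList a (suc n)) (suc n)                    ≡⟨ cong (coeff (inverseList a (suc n))) (inverseList-length a n) ⟨
    coeff (inverseList a (suc n)) (length (inverseList a n)) ≡⟨ coeff-++ʳ (inverseList a n) _ ⟩
    - inverseStep a n (inverseList a n) n                    ≡⟨ cong -_ (inverseStep-Σ a n ℕP.≤-refl) ⟩
    - Σ≤ n (λ i → a (suc n ∸ i) * inverse a i)               ∎
    where open ≡-Reasoning

  ⊛-inverseʳ : ∀ a → a 0 ≡ + 1 → a ⊛ inverse a ≈ 1ₛ
  ⊛-inverseʳ a a₀ zero    = cong (_* + 1) a₀
  ⊛-inverseʳ a a₀ (suc n) = begin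
    (a ⊛ inverse a) (suc n)                             ≡⟨ ⊛-comm a (inverse a) (suc n) ⟩
    (inverse a ⊛ a) (suc n)                             ≡⟨ ⊛-coeff (inverse a) a (suc n) ⟩
    Σ≤ n (λ i → inverse a i * a (suc n ∸ i)) + inverse a (suc n) * a (suc n ∸ suc n)
      ≡⟨ cong₂ _+_ (Σ≤-cong n (λ i _ → ℤP.*-comm (inverse a i) _)) (cong₂ _*_ (inverse-suc a n) (trans (cong a (ℕP.n∸n≡0 n)) a₀)) ⟩
    s + - s * + 1                                       ≡⟨ cancel s ⟩
    + 0                                                 ∎
    where
    open ≡-Reasoning
    s : ℤ
    s = Σ≤ n (λ i → a (suc n ∸ i) * inverse a i)
    cancel : ∀ s → s + - s * + 1 ≡ + 0
    cancel = solve-∀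

  inverse-unique : ∀ a b → a 0 ≡ + 1 → a ⊛ b ≈ 1ₛ → b ≈ inverse a
  inverse-unique a b a₀ ab≈1 = begin
    b                        ≈⟨ ⊛-identityʳ b ⟨
    b ⊛ 1ₛ                   ≈⟨ ⊛-congˡ b (⊛-inverseʳ a a₀) ⟨
    b ⊛ (a ⊛ inverse a)      ≈⟨ reassociate b a (inverse a) ⟩
    (a ⊛ b) ⊛ inverse a      ≈⟨ ⊛-congʳ (inverse a) ab≈1 ⟩
    1ₛ ⊛ inverse a           ≈⟨ ⊛-identityˡ (inverse a) ⟩
    inverse a                ∎
    where
    open ≈-Reasoning
    reassociate : ∀ b a i → b ⊛ (a ⊛ i) ≈ (a ⊛ b) ⊛ i
    reassociate = solve 3 (λ b a i → b :* (a :* i) := (a :* b) :* i) ≈-refl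

  ⊛-inverse-⊛ : ∀ a x → a 0 ≡ + 1 → x 0 ≡ + 1 → a ⊛ inverse (a ⊛ x) ≈ inverse x
  ⊛-inverse-⊛ a x a₀ x₀ = inverse-unique x (a ⊛ inverse (a ⊛ x)) x₀ (begin
    x ⊛ (a ⊛ inverse (a ⊛ x))  ≈⟨ reassociate x a (inverse (a ⊛ x)) ⟩
    (a ⊛ x) ⊛ inverse (a ⊛ x)  ≈⟨ ⊛-inverseʳ (a ⊛ x) (cong₂ _*_ a₀ x₀) ⟩
    1ₛ                         ∎)
    where
    open ≈-Reasoning
    reassociate : ∀ x a i → x ⊛ (a ⊛ i) ≈ (a ⊛ x) ⊛ i
    reassociate = solve 3 (λ x a i → x :* (a :* i) := (a :* x) :* i) ≈-refl

module Support where

  open import Data.Nat as ℕ using (ℕ; zero; suc; _∸_; _≤_; _<_; _≤ᵇ_; _≡ᵇ_; z≤n)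
  import Data.Nat.Properties as ℕP
  open import Data.Integer using (ℤ; +_; _+_; _*_; -_)
  import Data.Integer.Properties as ℤP
  open import Data.Integer.Divisibility.Signed using (_∣_; divides; ∣m∣n⇒∣m+n; ∣m⇒∣-m; ∣n⇒∣m*n; ∣m⇒∣m*n; 0∣⇒≡0)
  open import Data.Integer.Tactic.RingSolver using (solve-∀)
  open import Data.Bool using (Bool; true; false; T)
  open import Data.Bool.Properties using (T-≡)
  open import Function.Bundles using (Equivalence)
  open import Data.Empty using (⊥-elim)
  open import Relation.Binary.PropositionalEquality hiding ([_])
  open import Relation.Binary.Structures using (IsEquivalence)
  open import Relation.Binary.Bundles using (Setoid)
  import Relation.Binary.Reasoning.Setoid as SetoidReasoning
  open import Level using (0ℓ)
  open PowerSeries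

  true⇒≡ : ∀ m n → (m ≡ᵇ n) ≡ true → m ≡ n
  true⇒≡ m n e = ℕP.≡ᵇ⇒≡ m n (Equivalence.from T-≡ e)

  true⇒≤ : ∀ m n → (m ≤ᵇ n) ≡ true → m ≤ n
  true⇒≤ m n e = ℕP.≤ᵇ⇒≤ m n (Equivalence.from T-≡ e)

  Supported : ℤ → (ℕ → Bool) → Series → Set
  Supported M S f = ∀ n → S n ≡ false → M ∣ f n

  ∣0 : ∀ {M} → M ∣ + 0
  ∣0 = divides (+ 0) refl

  supported-0ₛ : ∀ {M S} → Supported M S 0ₛ
  supported-0ₛ _ _ = ∣0

  supported-everywhere : ∀ {M} f → Supported M (λ _ → true) f
  supported-everywhere f n ()

  supported-cong : ∀ {M S f g} → f ≈ g → Supported M S f → Supported M S g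
  supported-cong {M} f≈g sf n n∉S = subst (M ∣_) (f≈g n) (sf n n∉S)

  supported-weaken : ∀ {M S S′ f} → (∀ n → S n ≡ true → S′ n ≡ true) → Supported M S f → Supported M S′ f
  supported-weaken {S = S} S⊆S′ sf n n∉S′ with S n in eq
  ... | false = sf n eq
  ... | true  with () ← trans (sym (S⊆S′ n eq)) n∉S′

  supported-⊕ : ∀ {M S f g} → Supported M S f → Supported M S g → Supported M S (f ⊕ g)
  supported-⊕ sf sg n n∉S = ∣m∣n⇒∣m+n (sf n n∉S) (sg n n∉S)

  supported-⊝ : ∀ {M S f} → Supported M S f → Supported M S (⊝ f)
  supported-⊝ sf n n∉S = ∣m⇒∣-m (sf n n∉S)

  Σ≤-∣ : ∀ {M} k {h} → (∀ i → i ≤ k → M ∣ h i) → M ∣ Σ≤ k h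
  Σ≤-∣ zero    p = p 0 z≤n
  Σ≤-∣ (suc k) p = ∣m∣n⇒∣m+n (Σ≤-∣ k (λ i i≤k → p i (ℕP.m≤n⇒m≤1+n i≤k))) (p (suc k) ℕP.≤-refl)

  supported-⊛ : ∀ {M S T U f g} → Supported M S f → Supported M T g →
                (∀ i j → S i ≡ true → T j ≡ true → U (i ℕ.+ j) ≡ true) → Supported M U (f ⊛ g)
  supported-⊛ {M} {S} {T} {U} {f} {g} sf sg S+T⊆U n n∉U =
    subst (M ∣_) (sym (⊛-coeff f g n)) (Σ≤-∣ n term)
    where
    term : ∀ i → i ≤ n → M ∣ f i * g (n ∸ i)
    term i i≤n with S i in eS | T (n ∸ i) in eT
    ... | false | _     = ∣m⇒∣m*n (g (n ∸ i)) (sf i eS)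
    ... | true  | false = ∣n⇒∣m*n (f i) (sg (n ∸ i) eT)
    ... | true  | true  with () ← trans (sym (subst (λ m → U m ≡ true) (ℕP.m+[n∸m]≡n i≤n) (S+T⊆U i (n ∸ i) eS eT))) n∉U

  supported-[_]⊛ : ∀ {M S} c {f} → Supported M S f → Supported M S ([ c ] ⊛ f)
  supported-[_]⊛ {M} c {f} sf n n∉S = subst (M ∣_) (sym ([ c ]-⊛-coeff f n)) (∣n⇒∣m*n c (sf n n∉S))

  supported-sign⊛ : ∀ {M S} k {f} → Supported M S f → Supported M S (sign k ⊛ f)
  supported-sign⊛ zero    {f} sf = supported-cong (≈-sym (⊛-identityˡ f)) sf
  supported-sign⊛ (suc k) {f} sf = supported-cong (negate (sign k) f) (supported-⊝ (supported-sign⊛ k sf))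
    where
    negate : ∀ σ f → ⊝ (σ ⊛ f) ≈ ⊝ σ ⊛ f
    negate = solve 2 (λ σ f → :- (σ :* f) := (:- σ) :* f) ≈-refl

  [_]⊛-divisible : ∀ {S} c f → Supported c S ([ c ] ⊛ f)
  [_]⊛-divisible c f n _ = subst (c ∣_) (sym ([ c ]-⊛-coeff f n)) (divides (f n) (ℤP.*-comm c (f n)))

  supported-q^ : ∀ {M} e → Supported M (_≡ᵇ e) (q^ e)
  supported-q^ e n n≢e rewrite n≢e = ∣0

  supported-q^-∈ : ∀ {M S} e → S e ≡ true → Supported M S (q^ e)
  supported-q^-∈ {S = S} e e∈S = supported-weaken (λ n n≡e → subst (λ m → S m ≡ true) (sym (true⇒≡ n e n≡e)) e∈S) (supported-q^ e)

  supported-Σˢ≤ : ∀ {M S} k g → (∀ i → i ≤ k → Supported M S (g i)) → Supported M S (Σˢ≤ k g)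
  supported-Σˢ≤ zero    g p = p 0 z≤n
  supported-Σˢ≤ (suc k) g p = supported-⊕ (supported-Σˢ≤ k g (λ i i≤k → p i (ℕP.m≤n⇒m≤1+n i≤k))) (p (suc k) ℕP.≤-refl)

  -- Every term aₙ₊₁₋ᵢ bᵢ of the recursion for bₙ₊₁ has an index outside S
  -- when n + 1 is, because S is closed under addition.
  supported-inverse : ∀ {M S a} → a 0 ≡ + 1 → S 0 ≡ true → Supported M S a →
                      (∀ i j → S i ≡ true → S j ≡ true → S (i ℕ.+ j) ≡ true) → Supported M S (inverse a)
  supported-inverse {M} {S} {a} a₀ 0∈S sa S+S⊆S n = go n n ℕP.≤-refl
    where
    go : ∀ bound k → k ≤ bound → S k ≡ false → M ∣ inverse a k
    go bound   zero    _  0∉S with () ← trans (sym 0∈S) 0∉S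
    go (suc b) (suc k) k≤ k∉S = subst (M ∣_) (sym (inverse-suc a k)) (∣m⇒∣-m (Σ≤-∣ k term))
      where
      term : ∀ i → i ≤ k → M ∣ a (suc k ∸ i) * inverse a i
      term i i≤k with S i in eS | S (suc k ∸ i) in eS′
      ... | false | _     = ∣n⇒∣m*n (a (suc k ∸ i)) (go b i (ℕP.≤-trans i≤k (ℕP.≤-pred k≤)) eS)
      ... | true  | false = ∣m⇒∣m*n (inverse a i) (sa (suc k ∸ i) eS′)
      ... | true  | true  with () ← trans (sym (subst (λ m → S m ≡ true) (ℕP.m∸n+n≡m (ℕP.m≤n⇒m≤1+n i≤k)) (S+S⊆S (suc k ∸ i) i eS′ eS)))
                                         k∉S

  module Congruence (M : ℤ) (S : ℕ → Bool) (S-up : ∀ i j → S i ≡ true → S (i ℕ.+ j) ≡ true) where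

    -- A record rather than a function so that f and g can be inferred from f ~ g.
    infix 4 _~_
    record _~_ (f g : Series) : Set where
      constructor congruent
      field supported : Supported M S (f ⊖ g)
    open _~_ public

    supported-⊛ˡ : ∀ f {d} → Supported M S d → Supported M S (f ⊛ d)
    supported-⊛ˡ f sd = supported-⊛ (supported-everywhere f) sd
      (λ i j _ j∈S → subst (λ m → S m ≡ true) (ℕP.+-comm j i) (S-up j i j∈S))

    supported-⊛ʳ : ∀ {d} f → Supported M S d → Supported M S (d ⊛ f)
    supported-⊛ʳ f sd = supported-⊛ sd (supported-everywhere f) (λ i j i∈S _ → S-up i j i∈S)

    ≈⇒~ : ∀ {f g} → f ≈ g → f ~ g
    ≈⇒~ {f} {g} f≈g = congruent (λ n _ → subst (M ∣_) (trans (sym (ℤP.+-inverseʳ (g n))) (cong (_+ - g n) (sym (f≈g n)))) ∣0)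

    ~-refl : ∀ {f} → f ~ f
    ~-refl = ≈⇒~ ≈-refl

    ~-sym : ∀ {f g} → f ~ g → g ~ f
    ~-sym {f} {g} (congruent p) = congruent (λ n n∉S → subst (M ∣_) (flip (f n) (g n)) (∣m⇒∣-m (p n n∉S)))
      where
      flip : ∀ a b → - (a + - b) ≡ b + - a
      flip = solve-∀

    ~-trans : ∀ {f g h} → f ~ g → g ~ h → f ~ h
    ~-trans {f} {g} {h} (congruent p) (congruent q) =
      congruent (λ n n∉S → subst (M ∣_) (telescope (f n) (g n) (h n)) (∣m∣n⇒∣m+n (p n n∉S) (q n n∉S)))
      where
      telescope : ∀ a b c → (a + - b) + (b + - c) ≡ a + - c
      telescope = solve-∀

    ~-isEquivalence : IsEquivalence _~_
    ~-isEquivalence = record { refl = ~-refl ; sym = ~-sym ; trans = ~-trans }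

    ~-setoid : Setoid 0ℓ 0ℓ
    ~-setoid = record { isEquivalence = ~-isEquivalence }

    module ~-Reasoning = SetoidReasoning ~-setoid

    ~-⊕ : ∀ {f g f′ g′} → f ~ f′ → g ~ g′ → f ⊕ g ~ f′ ⊕ g′
    ~-⊕ {f} {g} {f′} {g′} (congruent p) (congruent q) = congruent (supported-cong (≈-sym (regroup f g f′ g′)) (supported-⊕ p q))
      where
      regroup : ∀ f g f′ g′ → f ⊕ g ⊖ (f′ ⊕ g′) ≈ (f ⊖ f′) ⊕ (g ⊖ g′)
      regroup = solve 4 (λ f g f′ g′ → f :+ g :- (f′ :+ g′) := (f :- f′) :+ (g :- g′)) ≈-refl

    ~-⊝ : ∀ {f f′} → f ~ f′ → ⊝ f ~ ⊝ f′
    ~-⊝ {f} {f′} (congruent p) = congruent (supported-cong (≈-sym (regroup f f′)) (supported-⊝ p))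
      where
      regroup : ∀ f f′ → ⊝ f ⊖ ⊝ f′ ≈ ⊝ (f ⊖ f′)
      regroup = solve 2 (λ f f′ → :- f :- (:- f′) := :- (f :- f′)) ≈-refl

    ~-⊛ : ∀ {f g f′ g′} → f ~ f′ → g ~ g′ → f ⊛ g ~ f′ ⊛ g′
    ~-⊛ {f} {g} {f′} {g′} (congruent p) (congruent q) =
      congruent (supported-cong (≈-sym (regroup f g f′ g′)) (supported-⊕ (supported-⊛ˡ f q) (supported-⊛ʳ g′ p)))
      where
      regroup : ∀ f g f′ g′ → f ⊛ g ⊖ f′ ⊛ g′ ≈ f ⊛ (g ⊖ g′) ⊕ (f ⊖ f′) ⊛ g′
      regroup = solve 4 (λ f g f′ g′ → f :* g :- f′ :* g′ := f :* (g :- g′) :+ (f :- f′) :* g′) ≈-refl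

    ~-⊛ˡ : ∀ f {g g′} → g ~ g′ → f ⊛ g ~ f ⊛ g′
    ~-⊛ˡ f = ~-⊛ (~-refl {f})

    ~-⊛ʳ : ∀ {f f′} g → f ~ f′ → f ⊛ g ~ f′ ⊛ g
    ~-⊛ʳ g p = ~-⊛ p ~-refl

    ~-^ : ∀ {f f′} e → f ~ f′ → f ^ e ~ f′ ^ e
    ~-^ zero    p = ~-refl
    ~-^ (suc e) p = ~-⊛ p (~-^ e p)

    ~-Σˢ≤ : ∀ k {g g′} → (∀ i → i ≤ k → g i ~ g′ i) → Σˢ≤ k g ~ Σˢ≤ k g′
    ~-Σˢ≤ zero    p = p 0 z≤n
    ~-Σˢ≤ (suc k) p = ~-⊕ (~-Σˢ≤ k (λ i i≤k → p i (ℕP.m≤n⇒m≤1+n i≤k))) (p (suc k) ℕP.≤-refl)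

    ~-inverse : ∀ {f g} → f 0 ≡ + 1 → g 0 ≡ + 1 → f ~ g → inverse f ~ inverse g
    ~-inverse {f} {g} f₀ g₀ p = congruent (supported-cong difference (supported-⊛ˡ (inverse f ⊛ inverse g) (supported (~-sym p))))
      where
      difference : (inverse f ⊛ inverse g) ⊛ (g ⊖ f) ≈ inverse f ⊖ inverse g
      difference = begin
        (inverse f ⊛ inverse g) ⊛ (g ⊖ f)                         ≈⟨ expand f g (inverse f) (inverse g) ⟩
        inverse f ⊛ (g ⊛ inverse g) ⊖ inverse g ⊛ (f ⊛ inverse f)
          ≈⟨ ⊕-cong (⊛-congˡ (inverse f) (⊛-inverseʳ g g₀)) (⊝-cong (⊛-congˡ (inverse g) (⊛-inverseʳ f f₀))) ⟩
        inverse f ⊛ 1ₛ ⊖ inverse g ⊛ 1ₛ                           ≈⟨ ⊕-cong (⊛-identityʳ _) (⊝-cong (⊛-identityʳ _)) ⟩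
        inverse f ⊖ inverse g                                     ∎
        where
        open ≈-Reasoning
        expand : ∀ f g i j → (i ⊛ j) ⊛ (g ⊖ f) ≈ i ⊛ (g ⊛ j) ⊖ j ⊛ (f ⊛ i)
        expand = solve 4 (λ f g i j → (i :* j) :* (g :- f) := i :* (g :* j) :- j :* (f :* i)) ≈-refl

    ⊛-inverse-~ : ∀ {a b x} → a 0 ≡ + 1 → b 0 ≡ + 1 → x 0 ≡ + 1 → b ~ a ⊛ x → a ⊛ inverse b ~ inverse x
    ⊛-inverse-~ {a} {b} {x} a₀ b₀ x₀ b~ax = begin
      a ⊛ inverse b        ≈⟨ ~-⊛ˡ a (~-inverse b₀ (cong₂ _*_ a₀ x₀) b~ax) ⟩
      a ⊛ inverse (a ⊛ x)  ≈⟨ ≈⇒~ (⊛-inverse-⊛ a x a₀ x₀) ⟩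
      inverse x            ∎
      where open ~-Reasoning

  ≤⇒true : ∀ {m n} → m ≤ n → (m ≤ᵇ n) ≡ true
  ≤⇒true m≤n = Equivalence.to T-≡ (ℕP.≤⇒≤ᵇ m≤n)

  ≤ᵇ-up : ∀ L i j → (L ≤ᵇ i) ≡ true → (L ≤ᵇ i ℕ.+ j) ≡ true
  ≤ᵇ-up L i j L≤i = ≤⇒true (ℕP.≤-trans (true⇒≤ L i L≤i) (ℕP.m≤m+n i j))

  module ModQ (L : ℕ) = Congruence (+ 0) (L ≤ᵇ_) (≤ᵇ-up L)

  module Mod (M : ℤ) = Congruence M (λ _ → false) (λ _ _ ())

  infix 4 _≈_mod-q^_ _≈_mod_
  _≈_mod-q^_ : Series → Series → ℕ → Set
  f ≈ g mod-q^ L = ModQ._~_ L f g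

  _≈_mod_ : Series → Series → ℤ → Set
  f ≈ g mod M = Mod._~_ M f g

  <⇒false : ∀ {m n} → m < n → (n ≤ᵇ m) ≡ false
  <⇒false {m} {n} m<n with n ≤ᵇ m in e
  ... | false = refl
  ... | true  = ⊥-elim (ℕP.<⇒≱ m<n (true⇒≤ n m e))

  [_]⊛-mod : ∀ c f → [ c ] ⊛ f ≈ 0ₛ mod c
  [ c ]⊛-mod f = Mod.congruent (supported-cong (λ n → sym (ℤP.+-identityʳ _)) ([ c ]⊛-divisible f))

  1ₛ⊕2⊛-mod-2 : ∀ {t} A → t ≈ 1ₛ → t ⊕ [ + 2 ] ⊛ A ≈ 1ₛ mod (+ 2)
  1ₛ⊕2⊛-mod-2 {t} A t≈1 = Mod.congruent (supported-cong (≈-sym (regroup t A 1ₛ))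
    (supported-⊕ (λ n _ → subst (+ 2 ∣_) (sym (trans (cong (_+ - 1ₛ n) (t≈1 n)) (ℤP.+-inverseʳ (1ₛ n)))) ∣0)
                 ([ + 2 ]⊛-divisible A)))
    where
    regroup : ∀ t A o → t ⊕ [ + 2 ] ⊛ A ⊖ o ≈ (t ⊖ o) ⊕ [ + 2 ] ⊛ A
    regroup = solve 3 (λ t A o → t :+ con (+ 2) :* A :- o := (t :- o) :+ con (+ 2) :* A) ≈-refl

  square-mod-4 : ∀ {a} → a ≈ 1ₛ mod (+ 2) → a ⊛ a ≈ 1ₛ mod (+ 4)
  square-mod-4 {a} (Mod.congruent a≡1) = Mod.congruent (supported-cong (≈-sym (begin
      a ⊛ a ⊖ 1ₛ                                           ≈⟨ ⊕-congʳ (⊝ 1ₛ) (⊛-cong a≈ a≈) ⟩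
      (1ₛ ⊕ [ + 2 ] ⊛ c) ⊛ (1ₛ ⊕ [ + 2 ] ⊛ c) ⊖ 1ₛ          ≈⟨ expand c ⟩
      [ + 4 ] ⊛ (c ⊕ c ⊛ c)                                ∎))
    ([ + 4 ]⊛-divisible (c ⊕ c ⊛ c)))
    where
    open ≈-Reasoning
    c : Series
    c n = _∣_.quotient (a≡1 n refl)
    a≈ : a ≈ 1ₛ ⊕ [ + 2 ] ⊛ c
    a≈ n = trans (shift (a n) (1ₛ n))
                 (cong (_+_ (1ₛ n)) (trans (_∣_.equality (a≡1 n refl)) (trans (ℤP.*-comm (c n) (+ 2)) (sym ([ + 2 ]-⊛-coeff c n)))))
      where
      shift : ∀ a o → a ≡ o + (a + - o)
      shift = solve-∀
    expand : ∀ c → (1ₛ ⊕ [ + 2 ] ⊛ c) ⊛ (1ₛ ⊕ [ + 2 ] ⊛ c) ⊖ 1ₛ ≈ [ + 4 ] ⊛ (c ⊕ c ⊛ c)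
    expand = solve 1 (λ c → (con (+ 1) :+ con (+ 2) :* c) :* (con (+ 1) :+ con (+ 2) :* c) :- con (+ 1) := con (+ 4) :* (c :+ c :* c)) ≈-refl

  mod-q^-coeff : ∀ {L f g} → f ≈ g mod-q^ L → ∀ {n} → n < L → f n ≡ g n
  mod-q^-coeff {L} {f} {g} (ModQ.congruent p) {n} n<L = ℤP.i-j≡0⇒i≡j (f n) (g n) (0∣⇒≡0 (p n (<⇒false n<L)))

  mod-q^-weaken : ∀ {L L′ f g} → L′ ≤ L → f ≈ g mod-q^ L → f ≈ g mod-q^ L′
  mod-q^-weaken {L′ = L′} L′≤L (ModQ.congruent p) =
    ModQ.congruent {L′} (supported-weaken (λ n L≤n → ≤⇒true (ℕP.≤-trans L′≤L (true⇒≤ _ n L≤n))) p)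

  q^-mod-q^ : ∀ {L} e → L ≤ e → q^ e ≈ 0ₛ mod-q^ L
  q^-mod-q^ {L} e L≤e = ModQ.congruent {L} (supported-cong (λ n → sym (ℤP.+-identityʳ _)) (supported-q^-∈ e (≤⇒true L≤e)))

  1-q^-mod-q^ : ∀ {L} e → L ≤ e → 1ₛ ⊖ q^ e ≈ 1ₛ mod-q^ L
  1-q^-mod-q^ {L} e L≤e = begin
    1ₛ ⊖ q^ e  ≈⟨ ~-⊕ (~-refl {1ₛ}) (~-⊝ (q^-mod-q^ e L≤e)) ⟩
    1ₛ ⊖ 0ₛ    ≈⟨ ≈⇒~ (λ n → ℤP.+-identityʳ (1ₛ n)) ⟩
    1ₛ         ∎
    where
    open ModQ L
    open ~-Reasoning

  q^-⊛-mod-q^ : ∀ {L f g} e → f ≈ g mod-q^ L → q^ e ⊛ f ≈ q^ e ⊛ g mod-q^ (e ℕ.+ L)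
  q^-⊛-mod-q^ {L} {f} {g} e (ModQ.congruent p) = ModQ.congruent {e ℕ.+ L} (supported-cong (≈-sym (factor (q^ e) f g))
    (supported-⊛ (supported-q^ e) p (λ i j i≡e L≤j →
      ≤⇒true (subst (λ i → e ℕ.+ L ≤ i ℕ.+ j) (sym (true⇒≡ i e i≡e)) (ℕP.+-monoʳ-≤ e (true⇒≤ L j L≤j))))))
    where
    factor : ∀ m f g → m ⊛ f ⊖ m ⊛ g ≈ m ⊛ (f ⊖ g)
    factor = solve 3 (λ m f g → m :* f :- m :* g := m :* (f :- g)) ≈-refl

module EulerProduct where

  open import Data.Nat as ℕ using (ℕ; zero; suc; s≤s)
  import Data.Nat.Properties as ℕP
  open import Data.Integer using (+_)
  open import Relation.Binary.PropositionalEquality hiding ([_])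
  open PowerSeries
  open Support

  eulerProduct : ℕ → ℕ → Series
  eulerProduct H zero    = 1ₛ
  eulerProduct H (suc k) = (1ₛ ⊖ q^ (H ℕ.* suc k)) ⊛ eulerProduct H k

  eulerProduct-unit : ∀ H K → eulerProduct (suc H) K 0 ≡ + 1
  eulerProduct-unit H zero    = refl
  eulerProduct-unit H (suc K) = cong (+ 1 ℤ.*_) (eulerProduct-unit H K)
    where import Data.Integer as ℤ

  eulerProduct-mod-q^ : ∀ H K → eulerProduct H K ≈ 1ₛ mod-q^ H
  eulerProduct-mod-q^ H zero    = ModQ.~-refl H
  eulerProduct-mod-q^ H (suc K) = begin
    (1ₛ ⊖ q^ (H ℕ.* suc K)) ⊛ eulerProduct H K  ≈⟨ ~-⊛ (1-q^-mod-q^ (H ℕ.* suc K) (ℕP.m≤m*n H (suc K))) (eulerProduct-mod-q^ H K) ⟩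
    1ₛ ⊛ 1ₛ                                    ≈⟨ ≈⇒~ (⊛-identityˡ 1ₛ) ⟩
    1ₛ                                         ∎
    where
    open ModQ H
    open ~-Reasoning

  eulerProduct-stable : ∀ H K d → eulerProduct H (d ℕ.+ K) ≈ eulerProduct H K mod-q^ (H ℕ.* suc K)
  eulerProduct-stable H K zero    = ModQ.~-refl (H ℕ.* suc K)
  eulerProduct-stable H K (suc d) = begin
    (1ₛ ⊖ q^ (H ℕ.* suc (d ℕ.+ K))) ⊛ eulerProduct H (d ℕ.+ K)
      ≈⟨ ~-⊛ (1-q^-mod-q^ _ (ℕP.*-monoʳ-≤ H (s≤s (ℕP.m≤n+m K d)))) (eulerProduct-stable H K d) ⟩
    1ₛ ⊛ eulerProduct H K
      ≈⟨ ≈⇒~ (⊛-identityˡ _) ⟩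
    eulerProduct H K
      ∎
    where
    open ModQ (H ℕ.* suc K)
    open ~-Reasoning

module Gauss (h : ℕ) where

  open import Data.Nat as ℕ using (ℕ; zero; suc; _∸_; _≤_; _<_; z≤n; s≤s)
  import Data.Nat.Properties as ℕP
  open import Data.Nat.Tactic.RingSolver using () renaming (solve-∀ to ℕ-solve)
  open import Data.Integer as ℤ using (ℤ; +_)
  import Data.Integer.Properties as ℤP
  open import Data.Bool using (if_then_else_)
  open import Data.Product using (_,_)
  open import Data.Sum using (inj₁; inj₂)
  open import Relation.Binary.PropositionalEquality hiding ([_])
  open PowerSeries
  open Support
  open EulerProduct

  x^_ : ℕ → Series
  x^ n = q^ (h ℕ.* n)

  x^-+ : ∀ a b → x^ a ⊛ x^ b ≈ x^ (a ℕ.+ b)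
  x^-+ a b = ≈-trans (q^-+ (h ℕ.* a) (h ℕ.* b)) (q^-cong (sym (ℕP.*-distribˡ-+ h a b)))

  x^-split : ∀ a b {c} → a ℕ.+ b ≡ c → x^ c ≈ x^ a ⊛ x^ b
  x^-split a b refl = ≈-sym (x^-+ a b)

  x^-cong : ∀ {a b} → a ≡ b → x^ a ≈ x^ b
  x^-cong refl = ≈-refl

  x^-regroup : ∀ a b c d → a ℕ.+ b ≡ c ℕ.+ d → x^ a ⊛ x^ b ≈ x^ c ⊛ x^ d
  x^-regroup a b c d eq = ≈-trans (x^-+ a b) (≈-trans (x^-cong eq) (≈-sym (x^-+ c d)))

  x^0 : x^ 0 ≈ 1ₛ
  x^0 = ≈-trans (q^-cong (ℕP.*-zeroʳ h)) q^0

  Q^_ : ℕ → Series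
  Q^ k = x^ (2 ℕ.* k)

  Q^-+ : ∀ i j → Q^ i ⊛ Q^ j ≈ Q^ (i ℕ.+ j)
  Q^-+ i j = ≈-trans (x^-+ (2 ℕ.* i) (2 ℕ.* j)) (x^-cong (sym (ℕP.*-distribˡ-+ 2 i j)))

  Q^-cong : ∀ {i j} → i ≡ j → Q^ i ≈ Q^ j
  Q^-cong refl = ≈-refl

  x^-⊛-Q^ : ∀ a b c d B → a ℕ.+ 2 ℕ.* b ≡ c ℕ.+ d → x^ a ⊛ Q^ b ⊛ B ≈ x^ c ⊛ (x^ d ⊛ B)
  x^-⊛-Q^ a b c d B eq = ≈-trans (⊛-congʳ B (x^-regroup a (2 ℕ.* b) c d eq)) (⊛-assoc (x^ c) (x^ d) B)

  xOdd : ℕ → Series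
  xOdd n = x^ suc (n ℕ.+ n)

  1-x^-mod-q^ : ∀ {L} e → L ≤ e → 1ₛ ⊖ x^ e ≈ 1ₛ mod-q^ (h ℕ.* L)
  1-x^-mod-q^ e L≤e = 1-q^-mod-q^ (h ℕ.* e) (ℕP.*-monoʳ-≤ h L≤e)

  eulerFactor≈Q^ : ∀ n → 1ₛ ⊖ q^ (2 ℕ.* h ℕ.* n) ≈ 1ₛ ⊖ Q^ n
  eulerFactor≈Q^ n = ⊕-congˡ 1ₛ (⊝-cong (q^-cong (exponent h n)))
    where
    exponent : ∀ h n → 2 ℕ.* h ℕ.* n ≡ h ℕ.* (2 ℕ.* n)
    exponent = ℕ-solve

  -- binomial a b is the Gaussian binomial coefficient [a + b, a] in the variable Q = x².
  binomial : ℕ → ℕ → Series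
  binomial zero    b       = 1ₛ
  binomial (suc a) zero    = 1ₛ
  binomial (suc a) (suc b) = binomial a (suc b) ⊕ Q^ (suc a) ⊛ binomial (suc a) b

  binomial-zeroʳ : ∀ a → binomial a 0 ≈ 1ₛ
  binomial-zeroʳ zero    = ≈-refl
  binomial-zeroʳ (suc a) = ≈-refl

  binomial-cong : ∀ {a a′} b → a ≡ a′ → binomial a b ≈ binomial a′ b
  binomial-cong b refl = ≈-refl

  private
    pascal-expand : ∀ o u X v → o ⊕ u ⊛ (X ⊕ v ⊛ o) ≈ (o ⊕ u ⊛ X) ⊕ (u ⊛ v) ⊛ o
    pascal-expand = solve 4 (λ o u X v → o :+ u :* (X :+ v :* o) := (o :+ u :* X) :+ (u :* v) :* o) ≈-refl

  binomial-pascalʳ : ∀ a b → binomial (suc a) (suc b) ≈ binomial (suc a) b ⊕ Q^ (suc b) ⊛ binomial a (suc b)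
  binomial-pascalʳ zero zero = ≈-refl
  binomial-pascalʳ zero (suc b) = begin
    1ₛ ⊕ Q^ 1 ⊛ binomial 1 (suc b)                        ≈⟨ ⊕-congˡ 1ₛ (⊛-congˡ (Q^ 1) (binomial-pascalʳ zero b)) ⟩
    1ₛ ⊕ Q^ 1 ⊛ (binomial 1 b ⊕ Q^ (suc b) ⊛ 1ₛ)          ≈⟨ pascal-expand 1ₛ (Q^ 1) (binomial 1 b) (Q^ (suc b)) ⟩
    (1ₛ ⊕ Q^ 1 ⊛ binomial 1 b) ⊕ (Q^ 1 ⊛ Q^ (suc b)) ⊛ 1ₛ ≈⟨ ⊕-congˡ (binomial 1 (suc b)) (⊛-congʳ 1ₛ (Q^-+ 1 (suc b))) ⟩
    binomial 1 (suc b) ⊕ Q^ (suc (suc b)) ⊛ 1ₛ            ∎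
    where open ≈-Reasoning
  binomial-pascalʳ (suc a) zero = begin
    binomial (suc a) 1 ⊕ Q^ (2 ℕ.+ a) ⊛ 1ₛ                       ≈⟨ ⊕-congʳ (Q^ (2 ℕ.+ a) ⊛ 1ₛ) (binomial-pascalʳ a zero) ⟩
    (1ₛ ⊕ Q^ 1 ⊛ binomial a 1) ⊕ Q^ (2 ℕ.+ a) ⊛ 1ₛ               ≈⟨ ⊕-congˡ (1ₛ ⊕ Q^ 1 ⊛ binomial a 1) (⊛-congʳ 1ₛ (Q^-+ 1 (suc a))) ⟨
    (1ₛ ⊕ Q^ 1 ⊛ binomial a 1) ⊕ (Q^ 1 ⊛ Q^ (suc a)) ⊛ 1ₛ        ≈⟨ pascal-expand 1ₛ (Q^ 1) (binomial a 1) (Q^ (suc a)) ⟨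
    1ₛ ⊕ Q^ 1 ⊛ (binomial a 1 ⊕ Q^ (suc a) ⊛ 1ₛ)                 ∎
    where open ≈-Reasoning
  binomial-pascalʳ (suc a) (suc b) = begin
    binomial (suc a) (2 ℕ.+ b) ⊕ u ⊛ binomial (2 ℕ.+ a) (suc b)
      ≈⟨ ⊕-cong (binomial-pascalʳ a (suc b)) (⊛-congˡ u (binomial-pascalʳ (suc a) b)) ⟩
    (X ⊕ w ⊛ Y) ⊕ u ⊛ (Z ⊕ v ⊛ X)
      ≈⟨ expand X Y Z u v w ⟩
    (X ⊕ u ⊛ Z) ⊕ (w ⊛ Y ⊕ (u ⊛ v) ⊛ X)
      ≈⟨ ⊕-congˡ (X ⊕ u ⊛ Z) (⊕-congˡ (w ⊛ Y) (⊛-congʳ X uv≈wt)) ⟩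
    (X ⊕ u ⊛ Z) ⊕ (w ⊛ Y ⊕ (w ⊛ t) ⊛ X)
      ≈⟨ factor X Y Z u w t ⟩
    (X ⊕ u ⊛ Z) ⊕ w ⊛ (Y ⊕ t ⊛ X)
      ∎
    where
    open ≈-Reasoning
    X Y Z u v w t : Series
    X = binomial (suc a) (suc b)
    Y = binomial a (2 ℕ.+ b)
    Z = binomial (2 ℕ.+ a) b
    u = Q^ (2 ℕ.+ a)
    v = Q^ (suc b)
    w = Q^ (2 ℕ.+ b)
    t = Q^ (suc a)
    uv≈wt : u ⊛ v ≈ w ⊛ t
    uv≈wt = ≈-trans (Q^-+ (2 ℕ.+ a) (suc b)) (≈-trans (Q^-cong (exponents a b)) (≈-sym (Q^-+ (2 ℕ.+ b) (suc a))))
      where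
      exponents : ∀ a b → 2 ℕ.+ a ℕ.+ suc b ≡ 2 ℕ.+ b ℕ.+ suc a
      exponents = ℕ-solve
    expand : ∀ X Y Z u v w → (X ⊕ w ⊛ Y) ⊕ u ⊛ (Z ⊕ v ⊛ X) ≈ (X ⊕ u ⊛ Z) ⊕ (w ⊛ Y ⊕ (u ⊛ v) ⊛ X)
    expand = solve 6 (λ X Y Z u v w → (X :+ w :* Y) :+ u :* (Z :+ v :* X) := (X :+ u :* Z) :+ (w :* Y :+ (u :* v) :* X)) ≈-refl
    factor : ∀ X Y Z u w t → (X ⊕ u ⊛ Z) ⊕ (w ⊛ Y ⊕ (w ⊛ t) ⊛ X) ≈ (X ⊕ u ⊛ Z) ⊕ w ⊛ (Y ⊕ t ⊛ X)
    factor = solve 6 (λ X Y Z u w t → (X :+ u :* Z) :+ (w :* Y :+ (w :* t) :* X) := (X :+ u :* Z) :+ w :* (Y :+ t :* X)) ≈-refl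

  binomial-sym : ∀ a b → binomial a b ≈ binomial b a
  binomial-sym zero    zero    = ≈-refl
  binomial-sym zero    (suc b) = ≈-refl
  binomial-sym (suc a) zero    = ≈-refl
  binomial-sym (suc a) (suc b) =
    ≈-trans (⊕-cong (binomial-sym a (suc b)) (⊛-congˡ (Q^ (suc a)) (binomial-sym (suc a) b)))
            (≈-sym (binomial-pascalʳ b a))

  binomial-three-term : ∀ a b → binomial (2 ℕ.+ a) (2 ℕ.+ b) ≈
    Q^ (2 ℕ.+ a) ⊛ binomial (2 ℕ.+ a) b ⊕ (1ₛ ⊕ Q^ (3 ℕ.+ (a ℕ.+ b))) ⊛ binomial (suc a) (suc b) ⊕ Q^ (2 ℕ.+ b) ⊛ binomial a (2 ℕ.+ b)
  binomial-three-term a b = begin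
    binomial (suc a) (2 ℕ.+ b) ⊕ u ⊛ binomial (2 ℕ.+ a) (suc b)
      ≈⟨ ⊕-cong (binomial-pascalʳ a (suc b)) (⊛-congˡ u (binomial-pascalʳ (suc a) b)) ⟩
    (Y ⊕ v ⊛ W) ⊕ u ⊛ (Z ⊕ r ⊛ Y)
      ≈⟨ regroup Y W Z u v r ⟩
    u ⊛ Z ⊕ (1ₛ ⊕ u ⊛ r) ⊛ Y ⊕ v ⊛ W
      ≈⟨ ⊕-congʳ (v ⊛ W) (⊕-congˡ (u ⊛ Z) (⊛-congʳ Y (⊕-congˡ 1ₛ (≈-trans (Q^-+ (2 ℕ.+ a) (suc b)) (Q^-cong (exponent a b)))))) ⟩
    u ⊛ Z ⊕ (1ₛ ⊕ Q^ (3 ℕ.+ (a ℕ.+ b))) ⊛ Y ⊕ v ⊛ W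
      ∎
    where
    open ≈-Reasoning
    Y W Z u v r : Series
    Y = binomial (suc a) (suc b)
    W = binomial a (2 ℕ.+ b)
    Z = binomial (2 ℕ.+ a) b
    u = Q^ (2 ℕ.+ a)
    v = Q^ (2 ℕ.+ b)
    r = Q^ (suc b)
    regroup : ∀ Y W Z u v r → (Y ⊕ v ⊛ W) ⊕ u ⊛ (Z ⊕ r ⊛ Y) ≈ u ⊛ Z ⊕ (1ₛ ⊕ u ⊛ r) ⊛ Y ⊕ v ⊛ W
    regroup = solve 6 (λ Y W Z u v r → (Y :+ v :* W) :+ u :* (Z :+ r :* Y) := u :* Z :+ (con (+ 1) :+ u :* r) :* Y :+ v :* W) ≈-refl
    exponent : ∀ a b → 2 ℕ.+ a ℕ.+ suc b ≡ 3 ℕ.+ (a ℕ.+ b)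
    exponent = ℕ-solve

  binomial-edge : ∀ a → binomial (2 ℕ.+ a) 1 ≈ (1ₛ ⊕ Q^ (2 ℕ.+ a)) ⊕ Q^ 1 ⊛ binomial a 1
  binomial-edge a =
    ≈-trans (⊕-congʳ (Q^ (2 ℕ.+ a) ⊛ 1ₛ) (binomial-pascalʳ a 0)) (regroup (Q^ 1) (binomial a 1) (Q^ (2 ℕ.+ a)))
    where
    regroup : ∀ u X m → (1ₛ ⊕ u ⊛ X) ⊕ m ⊛ 1ₛ ≈ (1ₛ ⊕ m) ⊕ u ⊛ X
    regroup = solve 3 (λ u X m → (con (+ 1) :+ u :* X) :+ m :* con (+ 1) := (con (+ 1) :+ m) :+ u :* X) ≈-refl

  binomial-⊛-1-Q^ : ∀ a b → binomial (suc a) (suc b) ⊛ (1ₛ ⊖ Q^ (suc a)) ≈ binomial a (suc b) ⊛ (1ₛ ⊖ Q^ (suc a ℕ.+ suc b))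
  binomial-⊛-1-Q^ a b = begin
    (X ⊕ t ⊛ Y) ⊛ (1ₛ ⊖ t)                ≈⟨ expand X Y t ⟩
    (X ⊕ t ⊛ Y) ⊖ t ⊛ (X ⊕ t ⊛ Y)         ≈⟨ ⊕-congˡ (X ⊕ t ⊛ Y) (⊝-cong (⊛-congˡ t (binomial-pascalʳ a b))) ⟩
    (X ⊕ t ⊛ Y) ⊖ t ⊛ (Y ⊕ s ⊛ X)         ≈⟨ collect X Y t s ⟩
    X ⊛ (1ₛ ⊖ t ⊛ s)                      ≈⟨ ⊛-congˡ X (⊕-congˡ 1ₛ (⊝-cong (Q^-+ (suc a) (suc b)))) ⟩
    X ⊛ (1ₛ ⊖ Q^ (suc a ℕ.+ suc b))       ∎
    where
    open ≈-Reasoning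
    X Y t s : Series
    X = binomial a (suc b)
    Y = binomial (suc a) b
    t = Q^ (suc a)
    s = Q^ (suc b)
    expand : ∀ X Y t → (X ⊕ t ⊛ Y) ⊛ (1ₛ ⊖ t) ≈ (X ⊕ t ⊛ Y) ⊖ t ⊛ (X ⊕ t ⊛ Y)
    expand = solve 3 (λ X Y t → (X :+ t :* Y) :* (con (+ 1) :- t) := (X :+ t :* Y) :- t :* (X :+ t :* Y)) ≈-refl
    collect : ∀ X Y t s → (X ⊕ t ⊛ Y) ⊖ t ⊛ (Y ⊕ s ⊛ X) ≈ X ⊛ (1ₛ ⊖ t ⊛ s)
    collect = solve 4 (λ X Y t s → (X :+ t :* Y) :- t :* (Y :+ s :* X) := X :* (con (+ 1) :- t :* s)) ≈-refl

  -- [a + b, a] (Q; Q)ₐ = (Q^{b+1}; Q)ₐ, which is 1 modulo Q^{b+1}.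
  binomial-⊛-eulerProduct : ∀ a b → binomial a b ⊛ eulerProduct (2 ℕ.* h) a ≈ 1ₛ mod-q^ (h ℕ.* (2 ℕ.* suc b))
  binomial-⊛-eulerProduct zero    b    = ModQ.≈⇒~ (h ℕ.* (2 ℕ.* suc b)) (⊛-identityˡ 1ₛ)
  binomial-⊛-eulerProduct (suc a) zero =
    ModQ.~-trans (h ℕ.* 2) (ModQ.≈⇒~ (h ℕ.* 2) (⊛-identityˡ _))
                   (mod-q^-weaken (ℕP.≤-reflexive (exponent h)) (eulerProduct-mod-q^ (2 ℕ.* h) (suc a)))
    where
    exponent : ∀ h → h ℕ.* (2 ℕ.* 1) ≡ 2 ℕ.* h
    exponent = ℕ-solve
  binomial-⊛-eulerProduct (suc a) (suc b) = begin
    binomial (suc a) (suc b) ⊛ ((1ₛ ⊖ q^ (2 ℕ.* h ℕ.* suc a)) ⊛ F)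
      ≈⟨ ≈⇒~ (⊛-congˡ (binomial (suc a) (suc b)) (⊛-congʳ F (eulerFactor≈Q^ (suc a)))) ⟩
    binomial (suc a) (suc b) ⊛ ((1ₛ ⊖ Q^ (suc a)) ⊛ F)
      ≈⟨ ≈⇒~ (⊛-assoc _ _ F) ⟨
    (binomial (suc a) (suc b) ⊛ (1ₛ ⊖ Q^ (suc a))) ⊛ F
      ≈⟨ ≈⇒~ (⊛-congʳ F (binomial-⊛-1-Q^ a b)) ⟩
    (binomial a (suc b) ⊛ (1ₛ ⊖ Q^ (suc a ℕ.+ suc b))) ⊛ F
      ≈⟨ ≈⇒~ (swap (binomial a (suc b)) (1ₛ ⊖ Q^ (suc a ℕ.+ suc b)) F) ⟩
    (1ₛ ⊖ Q^ (suc a ℕ.+ suc b)) ⊛ (binomial a (suc b) ⊛ F)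
      ≈⟨ ~-⊛ (1-x^-mod-q^ _ (ℕP.*-monoʳ-≤ 2 (s≤s (ℕP.m≤n+m (suc b) a)))) (binomial-⊛-eulerProduct a (suc b)) ⟩
    1ₛ ⊛ 1ₛ
      ≈⟨ ≈⇒~ (⊛-identityˡ 1ₛ) ⟩
    1ₛ
      ∎
    where
    open ModQ (h ℕ.* (2 ℕ.* suc (suc b)))
    open ~-Reasoning
    F : Series
    F = eulerProduct (2 ℕ.* h) a
    swap : ∀ X m F → (X ⊛ m) ⊛ F ≈ m ⊛ (X ⊛ F)
    swap = solve 3 (λ X m F → (X :* m) :* F := m :* (X :* F)) ≈-refl

  -- With n = k + r, G k r = x^{k²} [2n, n - k]_Q.
  G : ℕ → ℕ → Series
  G k r = x^ (k ℕ.* k) ⊛ binomial (k ℕ.+ k ℕ.+ r) r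

  G-suc-zero : ∀ k → G (suc k) 0 ≈ xOdd k ⊛ G k 0
  G-suc-zero k = begin
    x^ (suc k ℕ.* suc k) ⊛ 1ₛ
      ≈⟨ ⊛-cong (x^-split (suc (k ℕ.+ k)) (k ℕ.* k) (exponent k)) (≈-sym (binomial-zeroʳ (k ℕ.+ k ℕ.+ 0))) ⟩
    (xOdd k ⊛ x^ (k ℕ.* k)) ⊛ binomial (k ℕ.+ k ℕ.+ 0) 0
      ≈⟨ ⊛-assoc (xOdd k) (x^ (k ℕ.* k)) _ ⟩
    xOdd k ⊛ G k 0
      ∎
    where
    open ≈-Reasoning
    exponent : ∀ k → suc (k ℕ.+ k) ℕ.+ k ℕ.* k ≡ suc k ℕ.* suc k
    exponent = ℕ-solve

  G-suc-one : ∀ k → G (suc k) 1 ≈ (1ₛ ⊕ xOdd (suc k) ⊛ xOdd (suc k)) ⊛ G (suc k) 0 ⊕ xOdd (suc k) ⊛ G k 1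
  G-suc-one k = begin
    M ⊛ binomial (suc k ℕ.+ suc k ℕ.+ 1) 1
      ≈⟨ ⊛-congˡ M (≈-trans (binomial-cong 1 (index k)) (binomial-edge a)) ⟩
    M ⊛ ((1ₛ ⊕ Q^ (2 ℕ.+ a)) ⊕ Q^ 1 ⊛ binomial a 1)
      ≈⟨ distribute M (Q^ (2 ℕ.+ a)) (Q^ 1) (binomial a 1) ⟩
    (1ₛ ⊕ Q^ (2 ℕ.+ a)) ⊛ (M ⊛ 1ₛ) ⊕ M ⊛ Q^ 1 ⊛ binomial a 1
      ≈⟨ ⊕-cong (⊛-congʳ (M ⊛ 1ₛ) (⊕-congˡ 1ₛ (x^-split _ _ (square k))))
                (x^-⊛-Q^ (suc k ℕ.* suc k) 1 (suc (suc k ℕ.+ suc k)) (k ℕ.* k) _ (shift k)) ⟩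
    (1ₛ ⊕ xOdd (suc k) ⊛ xOdd (suc k)) ⊛ G (suc k) 0 ⊕ xOdd (suc k) ⊛ G k 1
      ∎
    where
    open ≈-Reasoning
    M : Series
    a : ℕ
    M = x^ (suc k ℕ.* suc k)
    a = k ℕ.+ k ℕ.+ 1
    distribute : ∀ M P p B → M ⊛ ((1ₛ ⊕ P) ⊕ p ⊛ B) ≈ (1ₛ ⊕ P) ⊛ (M ⊛ 1ₛ) ⊕ M ⊛ p ⊛ B
    distribute = solve 4 (λ M P p B → M :* ((con (+ 1) :+ P) :+ p :* B) := (con (+ 1) :+ P) :* (M :* con (+ 1)) :+ M :* p :* B) ≈-refl
    index : ∀ k → suc k ℕ.+ suc k ℕ.+ 1 ≡ 2 ℕ.+ (k ℕ.+ k ℕ.+ 1)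
    index = ℕ-solve
    square : ∀ k → suc (suc k ℕ.+ suc k) ℕ.+ suc (suc k ℕ.+ suc k) ≡ 2 ℕ.* (2 ℕ.+ (k ℕ.+ k ℕ.+ 1))
    square = ℕ-solve
    shift : ∀ k → suc k ℕ.* suc k ℕ.+ 2 ℕ.* 1 ≡ suc (suc k ℕ.+ suc k) ℕ.+ k ℕ.* k
    shift = ℕ-solve

  G-suc-suc : ∀ k s → G (suc k) (2 ℕ.+ s) ≈
    xOdd (k ℕ.+ (2 ℕ.+ s)) ⊛ G (2 ℕ.+ k) s ⊕ (1ₛ ⊕ xOdd (k ℕ.+ (2 ℕ.+ s)) ⊛ xOdd (k ℕ.+ (2 ℕ.+ s))) ⊛ G (suc k) (suc s)
      ⊕ xOdd (k ℕ.+ (2 ℕ.+ s)) ⊛ G k (2 ℕ.+ s)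
  G-suc-suc k s = begin
    M ⊛ binomial (suc k ℕ.+ suc k ℕ.+ (2 ℕ.+ s)) (2 ℕ.+ s)
      ≈⟨ ⊛-congˡ M (≈-trans (binomial-cong (2 ℕ.+ s) (index₁ k s)) (binomial-three-term a s)) ⟩
    M ⊛ (Q^ (2 ℕ.+ a) ⊛ Z ⊕ P ⊛ Y ⊕ Q^ (2 ℕ.+ s) ⊛ W)
      ≈⟨ distribute M (Q^ (2 ℕ.+ a)) (Q^ (2 ℕ.+ s)) P Y Z W ⟩
    M ⊛ Q^ (2 ℕ.+ a) ⊛ Z ⊕ P ⊛ (M ⊛ Y) ⊕ M ⊛ Q^ (2 ℕ.+ s) ⊛ W
      ≈⟨ ⊕-cong (⊕-cong (x^-⊛-Q^ _ (2 ℕ.+ a) _ ((2 ℕ.+ k) ℕ.* (2 ℕ.+ k)) Z (exponent₁ k s))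
                        (⊛-cong (⊕-congˡ 1ₛ (x^-split _ _ (exponent₂ k s))) (⊛-congˡ M (binomial-cong (suc s) (index₂ k s)))))
                (x^-⊛-Q^ _ (2 ℕ.+ s) _ (k ℕ.* k) W (exponent₃ k s)) ⟩
    x ⊛ (x^ ((2 ℕ.+ k) ℕ.* (2 ℕ.+ k)) ⊛ Z) ⊕ (1ₛ ⊕ x ⊛ x) ⊛ G (suc k) (suc s) ⊕ x ⊛ G k (2 ℕ.+ s)
      ≈⟨ ⊕-congʳ (x ⊛ G k (2 ℕ.+ s)) (⊕-congʳ ((1ₛ ⊕ x ⊛ x) ⊛ G (suc k) (suc s))
           (⊛-congˡ x (⊛-congˡ (x^ ((2 ℕ.+ k) ℕ.* (2 ℕ.+ k))) (binomial-cong s (index₃ k s))))) ⟩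
    x ⊛ G (2 ℕ.+ k) s ⊕ (1ₛ ⊕ x ⊛ x) ⊛ G (suc k) (suc s) ⊕ x ⊛ G k (2 ℕ.+ s)
      ∎
    where
    open ≈-Reasoning
    a : ℕ
    x M P Y Z W : Series
    a = k ℕ.+ k ℕ.+ (2 ℕ.+ s)
    x = xOdd (k ℕ.+ (2 ℕ.+ s))
    M = x^ (suc k ℕ.* suc k)
    P = 1ₛ ⊕ Q^ (3 ℕ.+ (a ℕ.+ s))
    Y = binomial (suc a) (suc s)
    Z = binomial (2 ℕ.+ a) s
    W = binomial a (2 ℕ.+ s)
    distribute : ∀ M u v P Y Z W → M ⊛ (u ⊛ Z ⊕ P ⊛ Y ⊕ v ⊛ W) ≈ M ⊛ u ⊛ Z ⊕ P ⊛ (M ⊛ Y) ⊕ M ⊛ v ⊛ W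
    distribute = solve 7 (λ M u v P Y Z W → M :* (u :* Z :+ P :* Y :+ v :* W) := M :* u :* Z :+ P :* (M :* Y) :+ M :* v :* W) ≈-refl
    index₁ : ∀ k s → suc k ℕ.+ suc k ℕ.+ (2 ℕ.+ s) ≡ 2 ℕ.+ (k ℕ.+ k ℕ.+ (2 ℕ.+ s))
    index₁ = ℕ-solve
    index₂ : ∀ k s → suc (k ℕ.+ k ℕ.+ (2 ℕ.+ s)) ≡ suc k ℕ.+ suc k ℕ.+ suc s
    index₂ = ℕ-solve
    index₃ : ∀ k s → 2 ℕ.+ (k ℕ.+ k ℕ.+ (2 ℕ.+ s)) ≡ (2 ℕ.+ k) ℕ.+ (2 ℕ.+ k) ℕ.+ s
    index₃ = ℕ-solve
    exponent₁ : ∀ k s → suc k ℕ.* suc k ℕ.+ 2 ℕ.* (2 ℕ.+ (k ℕ.+ k ℕ.+ (2 ℕ.+ s)))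
                      ≡ suc ((k ℕ.+ (2 ℕ.+ s)) ℕ.+ (k ℕ.+ (2 ℕ.+ s))) ℕ.+ (2 ℕ.+ k) ℕ.* (2 ℕ.+ k)
    exponent₁ = ℕ-solve
    exponent₂ : ∀ k s → suc ((k ℕ.+ (2 ℕ.+ s)) ℕ.+ (k ℕ.+ (2 ℕ.+ s))) ℕ.+ suc ((k ℕ.+ (2 ℕ.+ s)) ℕ.+ (k ℕ.+ (2 ℕ.+ s)))
                      ≡ 2 ℕ.* (3 ℕ.+ ((k ℕ.+ k ℕ.+ (2 ℕ.+ s)) ℕ.+ s))
    exponent₂ = ℕ-solve
    exponent₃ : ∀ k s → suc k ℕ.* suc k ℕ.+ 2 ℕ.* (2 ℕ.+ s) ≡ suc ((k ℕ.+ (2 ℕ.+ s)) ℕ.+ (k ℕ.+ (2 ℕ.+ s))) ℕ.+ k ℕ.* k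
    exponent₃ = ℕ-solve

  G-zero-one : G 0 1 ≈ (1ₛ ⊕ xOdd 0 ⊛ xOdd 0) ⊛ G 0 0
  G-zero-one = ≈-trans (regroup (x^ 0) (Q^ 1)) (⊛-congʳ (G 0 0) (⊕-congˡ 1ₛ (x^-split 1 1 refl)))
    where
    regroup : ∀ m p → m ⊛ (1ₛ ⊕ p ⊛ 1ₛ) ≈ (1ₛ ⊕ p) ⊛ (m ⊛ 1ₛ)
    regroup = solve 2 (λ m p → m :* (con (+ 1) :+ p :* con (+ 1)) := (con (+ 1) :+ p) :* (m :* con (+ 1))) ≈-refl

  G-zero-suc-suc : ∀ s → G 0 (2 ℕ.+ s) ≈ (1ₛ ⊕ xOdd (suc s) ⊛ xOdd (suc s)) ⊛ G 0 (suc s) ⊕ [ + 2 ] ⊛ (xOdd (suc s) ⊛ G 1 s)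
  G-zero-suc-suc s = begin
    m ⊛ binomial (2 ℕ.+ s) (2 ℕ.+ s)
      ≈⟨ ⊛-congˡ m (≈-trans (binomial-three-term s s) (⊕-congˡ (v ⊛ Z ⊕ P ⊛ Y) (⊛-congˡ v (binomial-sym s (2 ℕ.+ s))))) ⟩
    m ⊛ (v ⊛ Z ⊕ P ⊛ Y ⊕ v ⊛ Z)
      ≈⟨ collect m v P Y Z ⟩
    P ⊛ (m ⊛ Y) ⊕ [ + 2 ] ⊛ (m ⊛ v ⊛ Z)
      ≈⟨ ⊕-cong (⊛-congʳ (m ⊛ Y) (⊕-congˡ 1ₛ (x^-split _ _ (exponent₁ s))))
                (⊛-congˡ [ + 2 ] (x^-⊛-Q^ 0 (2 ℕ.+ s) _ 1 Z (exponent₂ s))) ⟩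
    (1ₛ ⊕ xOdd (suc s) ⊛ xOdd (suc s)) ⊛ G 0 (suc s) ⊕ [ + 2 ] ⊛ (xOdd (suc s) ⊛ G 1 s)
      ∎
    where
    open ≈-Reasoning
    m v P Y Z : Series
    m = x^ 0
    v = Q^ (2 ℕ.+ s)
    P = 1ₛ ⊕ Q^ (3 ℕ.+ (s ℕ.+ s))
    Y = binomial (suc s) (suc s)
    Z = binomial (2 ℕ.+ s) s
    collect : ∀ m v P Y Z → m ⊛ (v ⊛ Z ⊕ P ⊛ Y ⊕ v ⊛ Z) ≈ P ⊛ (m ⊛ Y) ⊕ [ + 2 ] ⊛ (m ⊛ v ⊛ Z)
    collect = solve 5 (λ m v P Y Z → m :* (v :* Z :+ P :* Y :+ v :* Z) := P :* (m :* Y) :+ con (+ 2) :* (m :* v :* Z)) ≈-refl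
    exponent₁ : ∀ s → suc (suc s ℕ.+ suc s) ℕ.+ suc (suc s ℕ.+ suc s) ≡ 2 ℕ.* (3 ℕ.+ (s ℕ.+ s))
    exponent₁ = ℕ-solve
    exponent₂ : ∀ s → 0 ℕ.+ 2 ℕ.* (2 ℕ.+ s) ≡ suc (suc s ℕ.+ suc s) ℕ.+ 1
    exponent₂ = ℕ-solve

  E : ℕ → ℕ → Series
  E k r = sign k ⊛ G k r

  threeTerm : Series → Series → Series → Series → Series
  threeTerm x a b c = ⊝ (x ⊛ a) ⊕ (1ₛ ⊕ x ⊛ x) ⊛ b ⊖ x ⊛ c

  threeTerm-cong : ∀ x {a a′ b b′ c c′} → a ≈ a′ → b ≈ b′ → c ≈ c′ → threeTerm x a b c ≈ threeTerm x a′ b′ c′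
  threeTerm-cong x a≈ b≈ c≈ = ⊕-cong (⊕-cong (⊝-cong (⊛-congˡ x a≈)) (⊛-congˡ (1ₛ ⊕ x ⊛ x) b≈)) (⊝-cong (⊛-congˡ x c≈))

  threeTerm-0ₛ : ∀ x b c → threeTerm x 0ₛ b c ≈ (1ₛ ⊕ x ⊛ x) ⊛ b ⊖ x ⊛ c
  threeTerm-0ₛ x b c n rewrite ⊛-zeroʳ x {0ₛ} ≈-refl n = cong (ℤ._+ (⊝ (x ⊛ c)) n) (ℤP.+-identityˡ (((1ₛ ⊕ x ⊛ x) ⊛ b) n))

  threeTerm-0ₛ-0ₛ : ∀ x c → threeTerm x 0ₛ 0ₛ c ≈ ⊝ (x ⊛ c)
  threeTerm-0ₛ-0ₛ x c n rewrite ⊛-zeroʳ x {0ₛ} ≈-refl n | ⊛-zeroʳ (1ₛ ⊕ x ⊛ x) {0ₛ} ≈-refl n = ℤP.+-identityˡ _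

  threeTerm-0ₛ-0ₛ-0ₛ : ∀ x → threeTerm x 0ₛ 0ₛ 0ₛ ≈ 0ₛ
  threeTerm-0ₛ-0ₛ-0ₛ x = ≈-trans (threeTerm-0ₛ-0ₛ x 0ₛ) (⊝-cong (⊛-zeroʳ x ≈-refl))

  E-suc-zero : ∀ k → E (suc k) 0 ≈ ⊝ (xOdd k ⊛ E k 0)
  E-suc-zero k = ≈-trans (⊛-congˡ (sign (suc k)) (G-suc-zero k)) (regroup (sign k) (xOdd k) (G k 0))
    where
    regroup : ∀ σ x g → ⊝ σ ⊛ (x ⊛ g) ≈ ⊝ (x ⊛ (σ ⊛ g))
    regroup = solve 3 (λ σ x g → (:- σ) :* (x :* g) := :- (x :* (σ :* g))) ≈-refl

  E-suc-one : ∀ k → E (suc k) 1 ≈ (1ₛ ⊕ xOdd (suc k) ⊛ xOdd (suc k)) ⊛ E (suc k) 0 ⊖ xOdd (suc k) ⊛ E k 1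
  E-suc-one k = ≈-trans (⊛-congˡ (sign (suc k)) (G-suc-one k)) (regroup (sign k) (xOdd (suc k)) (G (suc k) 0) (G k 1))
    where
    regroup : ∀ σ x g₁ g₀ → ⊝ σ ⊛ ((1ₛ ⊕ x ⊛ x) ⊛ g₁ ⊕ x ⊛ g₀) ≈ (1ₛ ⊕ x ⊛ x) ⊛ (⊝ σ ⊛ g₁) ⊖ x ⊛ (σ ⊛ g₀)
    regroup = solve 4 (λ σ x g₁ g₀ → (:- σ) :* ((con (+ 1) :+ x :* x) :* g₁ :+ x :* g₀)
                                   := (con (+ 1) :+ x :* x) :* ((:- σ) :* g₁) :- x :* (σ :* g₀)) ≈-refl

  E-suc-suc : ∀ k s → E (suc k) (2 ℕ.+ s) ≈ threeTerm (xOdd (k ℕ.+ (2 ℕ.+ s))) (E (2 ℕ.+ k) s) (E (suc k) (suc s)) (E k (2 ℕ.+ s))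
  E-suc-suc k s = ≈-trans (⊛-congˡ (sign (suc k)) (G-suc-suc k s))
                          (regroup (sign k) (xOdd (k ℕ.+ (2 ℕ.+ s))) (G (2 ℕ.+ k) s) (G (suc k) (suc s)) (G k (2 ℕ.+ s)))
    where
    regroup : ∀ σ x g₂ g₁ g₀ → ⊝ σ ⊛ (x ⊛ g₂ ⊕ (1ₛ ⊕ x ⊛ x) ⊛ g₁ ⊕ x ⊛ g₀)
                             ≈ ⊝ (x ⊛ (⊝ ⊝ σ ⊛ g₂)) ⊕ (1ₛ ⊕ x ⊛ x) ⊛ (⊝ σ ⊛ g₁) ⊖ x ⊛ (σ ⊛ g₀)
    regroup = solve 5 (λ σ x g₂ g₁ g₀ → (:- σ) :* (x :* g₂ :+ (con (+ 1) :+ x :* x) :* g₁ :+ x :* g₀)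
                                      := :- (x :* ((:- (:- σ)) :* g₂)) :+ (con (+ 1) :+ x :* x) :* ((:- σ) :* g₁) :- x :* (σ :* g₀)) ≈-refl

  E-zero-one : E 0 1 ≈ (1ₛ ⊕ xOdd 0 ⊛ xOdd 0) ⊛ E 0 0
  E-zero-one = ≈-trans (⊛-congˡ 1ₛ G-zero-one) (regroup (1ₛ ⊕ xOdd 0 ⊛ xOdd 0) (G 0 0))
    where
    regroup : ∀ p g → 1ₛ ⊛ (p ⊛ g) ≈ p ⊛ (1ₛ ⊛ g)
    regroup = solve 2 (λ p g → con (+ 1) :* (p :* g) := p :* (con (+ 1) :* g)) ≈-refl

  E-zero-suc-suc : ∀ s → E 0 (2 ℕ.+ s) ≈ (1ₛ ⊕ xOdd (suc s) ⊛ xOdd (suc s)) ⊛ E 0 (suc s) ⊖ [ + 2 ] ⊛ (xOdd (suc s) ⊛ E 1 s)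
  E-zero-suc-suc s = ≈-trans (⊛-congˡ 1ₛ (G-zero-suc-suc s)) (regroup (xOdd (suc s)) (G 0 (suc s)) (G 1 s))
    where
    regroup : ∀ x g₀ g₁ → 1ₛ ⊛ ((1ₛ ⊕ x ⊛ x) ⊛ g₀ ⊕ [ + 2 ] ⊛ (x ⊛ g₁))
                        ≈ (1ₛ ⊕ x ⊛ x) ⊛ (1ₛ ⊛ g₀) ⊖ [ + 2 ] ⊛ (x ⊛ (⊝ 1ₛ ⊛ g₁))
    regroup = solve 3 (λ x g₀ g₁ → con (+ 1) :* ((con (+ 1) :+ x :* x) :* g₀ :+ con (+ 2) :* (x :* g₁))
                                 := (con (+ 1) :+ x :* x) :* (con (+ 1) :* g₀) :- con (+ 2) :* (x :* ((:- con (+ 1)) :* g₁))) ≈-refl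

  term : ℕ → ℕ → Series
  term n k = if k ℕ.≤ᵇ n then E k (n ∸ k) else 0ₛ

  term-≤ : ∀ {n} k r → n ≡ k ℕ.+ r → term n k ≈ E k r
  term-≤ k r refl rewrite ≤⇒true (ℕP.m≤m+n k r) | ℕP.m+n∸m≡n k r = ≈-refl

  term-> : ∀ {n k} → n < k → term n k ≈ 0ₛ
  term-> n<k rewrite <⇒false n<k = ≈-refl

  data Position (n k : ℕ) : Set where
    below    : n < k → Position n k
    diagonal : n ≡ k → Position n k
    next     : n ≡ suc k → Position n k
    beyond   : ∀ s → n ≡ k ℕ.+ (2 ℕ.+ s) → Position n k

  position : ∀ n k → Position n k
  position zero          zero    = diagonal refl
  position (suc zero)    zero    = next refl
  position (suc (suc s)) zero    = beyond s refl
  position zero          (suc k) = below (s≤s z≤n)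
  position (suc n)       (suc k) with position n k
  ... | below n<k   = below (s≤s n<k)
  ... | diagonal eq = diagonal (cong suc eq)
  ... | next eq     = next (cong suc eq)
  ... | beyond s eq = beyond s (cong suc eq)

  term-suc-suc : ∀ n k → term (suc n) (suc k) ≈ threeTerm (xOdd n) (term n (2 ℕ.+ k)) (term n (suc k)) (term n k)
  term-suc-suc n k with position n k
  ... | below n<k = begin
    term (suc n) (suc k)                                        ≈⟨ term-> (s≤s n<k) ⟩
    0ₛ                                                          ≈⟨ threeTerm-0ₛ-0ₛ-0ₛ (xOdd n) ⟨
    threeTerm (xOdd n) 0ₛ 0ₛ 0ₛ
      ≈⟨ threeTerm-cong (xOdd n) (term-> (ℕP.m<n⇒m<1+n (ℕP.m<n⇒m<1+n n<k))) (term-> (ℕP.m<n⇒m<1+n n<k)) (term-> n<k) ⟨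
    threeTerm (xOdd n) (term n (2 ℕ.+ k)) (term n (suc k)) (term n k) ∎
    where open ≈-Reasoning
  ... | diagonal refl = begin
    term (suc k) (suc k)                                        ≈⟨ term-≤ (suc k) 0 (sym (ℕP.+-identityʳ (suc k))) ⟩
    E (suc k) 0                                                 ≈⟨ E-suc-zero k ⟩
    ⊝ (xOdd k ⊛ E k 0)                                          ≈⟨ threeTerm-0ₛ-0ₛ (xOdd k) (E k 0) ⟨
    threeTerm (xOdd k) 0ₛ 0ₛ (E k 0)
      ≈⟨ threeTerm-cong (xOdd k) (term-> (ℕP.m<n⇒m<1+n (ℕP.n<1+n k))) (term-> (ℕP.n<1+n k)) (term-≤ k 0 (sym (ℕP.+-identityʳ k))) ⟨
    threeTerm (xOdd k) (term k (2 ℕ.+ k)) (term k (suc k)) (term k k) ∎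
    where open ≈-Reasoning
  ... | next refl = begin
    term (2 ℕ.+ k) (suc k)                                      ≈⟨ term-≤ (suc k) 1 (ℕP.+-comm 1 (suc k)) ⟩
    E (suc k) 1                                                 ≈⟨ E-suc-one k ⟩
    (1ₛ ⊕ x ⊛ x) ⊛ E (suc k) 0 ⊖ x ⊛ E k 1                      ≈⟨ threeTerm-0ₛ x (E (suc k) 0) (E k 1) ⟨
    threeTerm x 0ₛ (E (suc k) 0) (E k 1)
      ≈⟨ threeTerm-cong x (term-> (ℕP.n<1+n (suc k))) (term-≤ (suc k) 0 (sym (ℕP.+-identityʳ (suc k)))) (term-≤ k 1 (ℕP.+-comm 1 k)) ⟨
    threeTerm x (term (suc k) (2 ℕ.+ k)) (term (suc k) (suc k)) (term (suc k) k) ∎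
    where
    open ≈-Reasoning
    x : Series
    x = xOdd (suc k)
  ... | beyond s refl = begin
    term (suc n) (suc k)                                        ≈⟨ term-≤ (suc k) (2 ℕ.+ s) refl ⟩
    E (suc k) (2 ℕ.+ s)                                         ≈⟨ E-suc-suc k s ⟩
    threeTerm (xOdd n) (E (2 ℕ.+ k) s) (E (suc k) (suc s)) (E k (2 ℕ.+ s))
      ≈⟨ threeTerm-cong (xOdd n) (term-≤ (2 ℕ.+ k) s (index₂ k s)) (term-≤ (suc k) (suc s) (index₁ k s)) (term-≤ k (2 ℕ.+ s) refl) ⟨
    threeTerm (xOdd n) (term n (2 ℕ.+ k)) (term n (suc k)) (term n k) ∎
    where
    open ≈-Reasoning
    index₁ : ∀ k s → k ℕ.+ (2 ℕ.+ s) ≡ suc k ℕ.+ suc s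
    index₁ = ℕ-solve
    index₂ : ∀ k s → k ℕ.+ (2 ℕ.+ s) ≡ 2 ℕ.+ k ℕ.+ s
    index₂ = ℕ-solve

  term-suc-zero : ∀ n → term (suc n) 0 ≈ (1ₛ ⊕ xOdd n ⊛ xOdd n) ⊛ term n 0 ⊖ [ + 2 ] ⊛ (xOdd n ⊛ term n 1)
  term-suc-zero zero    =
    ≈-trans E-zero-one (≈-sym (⊕-identityʳ _ (⊝-cong (⊛-zeroʳ [ + 2 ] (⊛-zeroʳ (xOdd 0) ≈-refl)))))
  term-suc-zero (suc s) = E-zero-suc-suc s

  Σˢ≤-threeTerm : ∀ x k a b c → Σˢ≤ k (λ i → threeTerm x (a i) (b i) (c i)) ≈ threeTerm x (Σˢ≤ k a) (Σˢ≤ k b) (Σˢ≤ k c)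
  Σˢ≤-threeTerm x zero    a b c = ≈-refl
  Σˢ≤-threeTerm x (suc k) a b c =
    ≈-trans (⊕-congʳ (threeTerm x (a (suc k)) (b (suc k)) (c (suc k))) (Σˢ≤-threeTerm x k a b c))
            (additive x (Σˢ≤ k a) (Σˢ≤ k b) (Σˢ≤ k c) (a (suc k)) (b (suc k)) (c (suc k)))
    where
    additive : ∀ x A B C a b c → threeTerm x A B C ⊕ threeTerm x a b c ≈ threeTerm x (A ⊕ a) (B ⊕ b) (C ⊕ c)
    additive = solve 7 (λ x A B C a b c →
      (:- (x :* A) :+ (con (+ 1) :+ x :* x) :* B :- x :* C) :+ (:- (x :* a) :+ (con (+ 1) :+ x :* x) :* b :- x :* c)
      := :- (x :* (A :+ a)) :+ (con (+ 1) :+ x :* x) :* (B :+ b) :- x :* (C :+ c)) ≈-refl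

  -- V n = Σ_{|k| ≤ n} (-1)^k x^{k²} [2n, n - k]_Q, the left side of the finite Gauss identity.
  V : ℕ → Series
  V n = term n 0 ⊕ [ + 2 ] ⊛ Σˢ≤ n (λ k → term n (suc k))

  V-suc : ∀ n → V (suc n) ≈ (1ₛ ⊖ xOdd n) ⊛ ((1ₛ ⊖ xOdd n) ⊛ V n)
  V-suc n = begin
    term (suc n) 0 ⊕ [ + 2 ] ⊛ Σˢ≤ (suc n) (λ k → term (suc n) (suc k))
      ≈⟨ ⊕-cong (term-suc-zero n) (⊛-congˡ [ + 2 ] (≈-trans (Σˢ≤-cong (suc n) (λ k _ → term-suc-suc n k))
                                                             (Σˢ≤-threeTerm x (suc n) (λ k → term n (2 ℕ.+ k)) (λ k → term n (suc k)) (term n)))) ⟩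
    (Q ⊛ e₀ ⊖ [ + 2 ] ⊛ (x ⊛ e₁)) ⊕ [ + 2 ] ⊛ threeTerm x S₂ S₁ S₀
      ≈⟨ ⊕-congˡ (Q ⊛ e₀ ⊖ [ + 2 ] ⊛ (x ⊛ e₁)) (⊛-congˡ [ + 2 ] (threeTerm-cong x far T≈ (≈-trans (Σˢ≤-peel n (term n)) (⊕-congˡ e₀ Tₙ≈)))) ⟩
    (Q ⊛ e₀ ⊖ [ + 2 ] ⊛ (x ⊛ e₁)) ⊕ [ + 2 ] ⊛ threeTerm x S (e₁ ⊕ S) (e₀ ⊕ (e₁ ⊕ S))
      ≈⟨ square x e₀ e₁ S ⟩
    (1ₛ ⊖ x) ⊛ ((1ₛ ⊖ x) ⊛ (e₀ ⊕ [ + 2 ] ⊛ (e₁ ⊕ S)))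
      ≈⟨ ⊛-congˡ (1ₛ ⊖ x) (⊛-congˡ (1ₛ ⊖ x) (⊕-congˡ e₀ (⊛-congˡ [ + 2 ] Tₙ≈))) ⟨
    (1ₛ ⊖ x) ⊛ ((1ₛ ⊖ x) ⊛ V n)
      ∎
    where
    open ≈-Reasoning
    x Q e₀ e₁ S S₂ S₁ S₀ : Series
    x = xOdd n
    Q = 1ₛ ⊕ x ⊛ x
    e₀ = term n 0
    e₁ = term n 1
    S = Σˢ≤ n (λ k → term n (2 ℕ.+ k))
    S₂ = Σˢ≤ (suc n) (λ k → term n (2 ℕ.+ k))
    S₁ = Σˢ≤ (suc n) (λ k → term n (suc k))
    S₀ = Σˢ≤ (suc n) (term n)
    T≈ : S₁ ≈ e₁ ⊕ S
    T≈ = Σˢ≤-peel n (λ k → term n (suc k))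
    Tₙ≈ : Σˢ≤ n (λ k → term n (suc k)) ≈ e₁ ⊕ S
    Tₙ≈ = ≈-trans (≈-sym (⊕-identityʳ _ (term-> (ℕP.m<n⇒m<1+n (ℕP.n<1+n n))))) T≈
    far : S₂ ≈ S
    far = ⊕-identityʳ S (term-> (ℕP.m<n⇒m<1+n (ℕP.m<n⇒m<1+n (ℕP.n<1+n n))))
    square : ∀ x e₀ e₁ S → ((1ₛ ⊕ x ⊛ x) ⊛ e₀ ⊖ [ + 2 ] ⊛ (x ⊛ e₁)) ⊕ [ + 2 ] ⊛ threeTerm x S (e₁ ⊕ S) (e₀ ⊕ (e₁ ⊕ S))
                               ≈ (1ₛ ⊖ x) ⊛ ((1ₛ ⊖ x) ⊛ (e₀ ⊕ [ + 2 ] ⊛ (e₁ ⊕ S)))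
    square = solve 4 (λ x e₀ e₁ S →
      ((con (+ 1) :+ x :* x) :* e₀ :- con (+ 2) :* (x :* e₁))
        :+ con (+ 2) :* (:- (x :* S) :+ (con (+ 1) :+ x :* x) :* (e₁ :+ S) :- x :* (e₀ :+ (e₁ :+ S)))
      := (con (+ 1) :- x) :* ((con (+ 1) :- x) :* (e₀ :+ con (+ 2) :* (e₁ :+ S)))) ≈-refl

  oddProduct : ℕ → Series
  oddProduct zero    = 1ₛ
  oddProduct (suc n) = (1ₛ ⊖ xOdd n) ⊛ oddProduct n

  V≈oddProduct² : ∀ n → V n ≈ oddProduct n ⊛ oddProduct n
  V≈oddProduct² zero    =
    ≈-trans (⊕-identityʳ _ (⊛-zeroʳ [ + 2 ] ≈-refl)) (⊛-congˡ 1ₛ (≈-trans (⊛-congʳ 1ₛ x^0) (⊛-identityˡ 1ₛ)))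
  V≈oddProduct² (suc n) =
    ≈-trans (V-suc n) (≈-trans (⊛-congˡ a (⊛-congˡ a (V≈oddProduct² n))) (regroup a (oddProduct n)))
    where
    a : Series
    a = 1ₛ ⊖ xOdd n
    regroup : ∀ a o → a ⊛ (a ⊛ (o ⊛ o)) ≈ (a ⊛ o) ⊛ (a ⊛ o)
    regroup = solve 2 (λ a o → a :* (a :* (o :* o)) := (a :* o) :* (a :* o)) ≈-refl

  eulerProduct-split : ∀ n → eulerProduct h (n ℕ.+ n) ≈ eulerProduct (2 ℕ.* h) n ⊛ oddProduct n
  eulerProduct-split zero    = ≈-sym (⊛-identityˡ 1ₛ)
  eulerProduct-split (suc n) = begin
    eulerProduct h (suc n ℕ.+ suc n)
      ≡⟨ cong (eulerProduct h) (double n) ⟩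
    (1ₛ ⊖ q^ (h ℕ.* suc (suc (n ℕ.+ n)))) ⊛ ((1ₛ ⊖ xOdd n) ⊛ eulerProduct h (n ℕ.+ n))
      ≈⟨ ⊛-cong (⊕-congˡ 1ₛ (⊝-cong (q^-cong (exponent h n)))) (⊛-congˡ (1ₛ ⊖ xOdd n) (eulerProduct-split n)) ⟩
    (1ₛ ⊖ q^ (2 ℕ.* h ℕ.* suc n)) ⊛ ((1ₛ ⊖ xOdd n) ⊛ (eulerProduct (2 ℕ.* h) n ⊛ oddProduct n))
      ≈⟨ interchange (1ₛ ⊖ q^ (2 ℕ.* h ℕ.* suc n)) (1ₛ ⊖ xOdd n) (eulerProduct (2 ℕ.* h) n) (oddProduct n) ⟩
    eulerProduct (2 ℕ.* h) (suc n) ⊛ oddProduct (suc n)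
      ∎
    where
    open ≈-Reasoning
    double : ∀ n → suc n ℕ.+ suc n ≡ suc (suc (n ℕ.+ n))
    double = ℕ-solve
    exponent : ∀ h n → h ℕ.* suc (suc (n ℕ.+ n)) ≡ 2 ℕ.* h ℕ.* suc n
    exponent = ℕ-solve
    interchange : ∀ a b F O → a ⊛ (b ⊛ (F ⊛ O)) ≈ (a ⊛ F) ⊛ (b ⊛ O)
    interchange = solve 4 (λ a b F O → a :* (b :* (F :* O)) := (a :* F) :* (b :* O)) ≈-refl

  θ : ℕ → Series
  θ k = sign k ⊛ x^ (k ℕ.* k)

  -- The truncation Σ_{|k| ≤ n + 1} (-1)^k x^{k²} of φ(-x).
  Θ : ℕ → Series
  Θ n = θ 0 ⊕ [ + 2 ] ⊛ Σˢ≤ n (λ k → θ (suc k))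

  private
    odd≤square+even : ∀ k r → suc ((k ℕ.+ r) ℕ.+ (k ℕ.+ r)) ≤ k ℕ.* k ℕ.+ 2 ℕ.* suc r
    odd≤square+even zero    r = subst (suc (r ℕ.+ r) ≤_) (shape₀ r) (ℕP.m≤m+n _ 1)
      where
      shape₀ : ∀ r → suc (r ℕ.+ r) ℕ.+ 1 ≡ 0 ℕ.+ 2 ℕ.* suc r
      shape₀ = ℕ-solve
    odd≤square+even (suc j) r = subst (suc ((suc j ℕ.+ r) ℕ.+ (suc j ℕ.+ r)) ≤_) (shape r j) (ℕP.m≤m+n _ (j ℕ.* j))
      where
      shape : ∀ r j → suc ((suc j ℕ.+ r) ℕ.+ (suc j ℕ.+ r)) ℕ.+ j ℕ.* j ≡ suc j ℕ.* suc j ℕ.+ 2 ℕ.* suc r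
      shape = ℕ-solve

  E-⊛-eulerProduct : ∀ k r → E k r ⊛ eulerProduct (2 ℕ.* h) (k ℕ.+ r) ≈ θ k mod-q^ (h ℕ.* suc ((k ℕ.+ r) ℕ.+ (k ℕ.+ r)))
  E-⊛-eulerProduct k r = begin
    (sign k ⊛ (M ⊛ B)) ⊛ F  ≈⟨ ≈⇒~ (reassociate (sign k) M B F) ⟩
    sign k ⊛ (M ⊛ (B ⊛ F))  ≈⟨ ~-⊛ˡ (sign k) (mod-q^-weaken (bound k r) (q^-⊛-mod-q^ (h ℕ.* (k ℕ.* k)) B⊛F≈1)) ⟩
    sign k ⊛ (M ⊛ 1ₛ)       ≈⟨ ≈⇒~ (⊛-congˡ (sign k) (⊛-identityʳ M)) ⟩
    θ k                     ∎
    where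
    open ModQ (h ℕ.* suc ((k ℕ.+ r) ℕ.+ (k ℕ.+ r)))
    open ~-Reasoning
    M B F : Series
    Lᵣ : ℕ
    M = x^ (k ℕ.* k)
    B = binomial (k ℕ.+ k ℕ.+ r) r
    F = eulerProduct (2 ℕ.* h) (k ℕ.+ r)
    Lᵣ = h ℕ.* (2 ℕ.* suc r)
    reassociate : ∀ σ M B F → (σ ⊛ (M ⊛ B)) ⊛ F ≈ σ ⊛ (M ⊛ (B ⊛ F))
    reassociate = solve 4 (λ σ M B F → (σ :* (M :* B)) :* F := σ :* (M :* (B :* F))) ≈-refl
    bound : ∀ k r → h ℕ.* suc ((k ℕ.+ r) ℕ.+ (k ℕ.+ r)) ≤ h ℕ.* (k ℕ.* k) ℕ.+ h ℕ.* (2 ℕ.* suc r)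
    bound k r = subst (h ℕ.* suc ((k ℕ.+ r) ℕ.+ (k ℕ.+ r)) ≤_) (ℕP.*-distribˡ-+ h (k ℕ.* k) _) (ℕP.*-monoʳ-≤ h (odd≤square+even k r))
    F-stable : eulerProduct (2 ℕ.* h) (k ℕ.+ k ℕ.+ r) ≈ F mod-q^ Lᵣ
    F-stable = mod-q^-weaken (subst (Lᵣ ≤_) (sym (split-modulus h k r)) (ℕP.m≤m+n Lᵣ (2 ℕ.* h ℕ.* k)))
      (subst (λ a → eulerProduct (2 ℕ.* h) a ≈ F mod-q^ (2 ℕ.* h ℕ.* suc (k ℕ.+ r)))
             (sym (ℕP.+-assoc k k r)) (eulerProduct-stable (2 ℕ.* h) (k ℕ.+ r) k))
      where
      split-modulus : ∀ h k r → 2 ℕ.* h ℕ.* suc (k ℕ.+ r) ≡ h ℕ.* (2 ℕ.* suc r) ℕ.+ 2 ℕ.* h ℕ.* k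
      split-modulus = ℕ-solve
    B⊛F≈1 : B ⊛ F ≈ 1ₛ mod-q^ Lᵣ
    B⊛F≈1 = ModQ.~-trans Lᵣ (ModQ.~-⊛ˡ Lᵣ B (ModQ.~-sym Lᵣ F-stable)) (binomial-⊛-eulerProduct (k ℕ.+ k ℕ.+ r) r)

  term-⊛-eulerProduct : ∀ n k → k ≤ suc n → term n k ⊛ eulerProduct (2 ℕ.* h) n ≈ θ k mod-q^ (h ℕ.* suc (n ℕ.+ n))
  term-⊛-eulerProduct n k k≤1+n with ℕP.m≤n⇒m<n∨m≡n k≤1+n
  ... | inj₁ (s≤s k≤n) with r , refl ← ℕP.m≤n⇒∃[o]m+o≡n k≤n =
    ModQ.~-trans L (ModQ.≈⇒~ L (⊛-congʳ (eulerProduct (2 ℕ.* h) n) (term-≤ k r refl))) (E-⊛-eulerProduct k r)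
    where
    L : ℕ
    L = h ℕ.* suc (n ℕ.+ n)
  ... | inj₂ refl = begin
    term n (suc n) ⊛ eulerProduct (2 ℕ.* h) n  ≈⟨ ≈⇒~ (⊛-zeroˡ _ (term-> (ℕP.n<1+n n))) ⟩
    0ₛ                                         ≈⟨ ≈⇒~ (⊛-zeroʳ (sign (suc n)) ≈-refl) ⟨
    sign (suc n) ⊛ 0ₛ                          ≈⟨ ~-⊛ˡ (sign (suc n)) (q^-mod-q^ _ (ℕP.*-monoʳ-≤ h (odd≤square n))) ⟨
    θ (suc n)                                  ∎
    where
    open ModQ (h ℕ.* suc (n ℕ.+ n))
    open ~-Reasoning
    odd≤square : ∀ n → suc (n ℕ.+ n) ≤ suc n ℕ.* suc n
    odd≤square n = subst (suc (n ℕ.+ n) ≤_) (square n) (ℕP.m≤m+n _ (n ℕ.* n))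
      where
      square : ∀ n → suc (n ℕ.+ n) ℕ.+ n ℕ.* n ≡ suc n ℕ.* suc n
      square = ℕ-solve

  V-⊛-eulerProduct : ∀ n → V n ⊛ eulerProduct (2 ℕ.* h) n ≈ Θ n mod-q^ (h ℕ.* suc (n ℕ.+ n))
  V-⊛-eulerProduct n = begin
    (term n 0 ⊕ [ + 2 ] ⊛ Σˢ≤ n (λ k → term n (suc k))) ⊛ F
      ≈⟨ ≈⇒~ (≈-trans (distribute (term n 0) (Σˢ≤ n (λ k → term n (suc k))) F)
                      (⊕-congˡ (term n 0 ⊛ F) (⊛-congˡ [ + 2 ] (≈-sym (Σˢ≤-⊛ n (λ k → term n (suc k)) F))))) ⟩
    term n 0 ⊛ F ⊕ [ + 2 ] ⊛ Σˢ≤ n (λ k → term n (suc k) ⊛ F)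
      ≈⟨ ~-⊕ (term-⊛-eulerProduct n 0 z≤n) (~-⊛ˡ [ + 2 ] (~-Σˢ≤ n (λ k k≤n → term-⊛-eulerProduct n (suc k) (s≤s k≤n)))) ⟩
    Θ n
      ∎
    where
    open ModQ (h ℕ.* suc (n ℕ.+ n))
    open ~-Reasoning
    F : Series
    F = eulerProduct (2 ℕ.* h) n
    distribute : ∀ a T F → (a ⊕ [ + 2 ] ⊛ T) ⊛ F ≈ a ⊛ F ⊕ [ + 2 ] ⊛ (T ⊛ F)
    distribute = solve 3 (λ a T F → (a :+ con (+ 2) :* T) :* F := a :* F :+ con (+ 2) :* (T :* F)) ≈-refl

  -- Finite form of f_h² = f_{2h} φ(-q^h): (x; x)₂ₙ² = (Q; Q)ₙ² (x; x²)ₙ² = (Q; Q)ₙ² V n.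
  eulerProduct²-double : ∀ n → eulerProduct h (n ℕ.+ n) ⊛ eulerProduct h (n ℕ.+ n)
                                ≈ eulerProduct (2 ℕ.* h) n ⊛ Θ n mod-q^ (h ℕ.* suc (n ℕ.+ n))
  eulerProduct²-double n = begin
    eulerProduct h (n ℕ.+ n) ⊛ eulerProduct h (n ℕ.+ n)
      ≈⟨ ≈⇒~ (⊛-cong (eulerProduct-split n) (eulerProduct-split n)) ⟩
    (F ⊛ oddProduct n) ⊛ (F ⊛ oddProduct n)
      ≈⟨ ≈⇒~ (regroup F (oddProduct n)) ⟩
    F ⊛ ((oddProduct n ⊛ oddProduct n) ⊛ F)
      ≈⟨ ≈⇒~ (⊛-congˡ F (⊛-congʳ F (V≈oddProduct² n))) ⟨
    F ⊛ (V n ⊛ F)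
      ≈⟨ ~-⊛ˡ F (V-⊛-eulerProduct n) ⟩
    F ⊛ Θ n
      ∎
    where
    open ModQ (h ℕ.* suc (n ℕ.+ n))
    open ~-Reasoning
    F : Series
    F = eulerProduct (2 ℕ.* h) n
    regroup : ∀ F O → (F ⊛ O) ⊛ (F ⊛ O) ≈ F ⊛ ((O ⊛ O) ⊛ F)
    regroup = solve 2 (λ F O → (F :* O) :* (F :* O) := F :* ((O :* O) :* F)) ≈-refl

  eulerProduct² : ∀ N .{{_ : ℕ.NonZero h}} → eulerProduct h N ⊛ eulerProduct h N ≈ eulerProduct (2 ℕ.* h) N ⊛ Θ N mod-q^ (suc N)
  eulerProduct² N = begin
    eulerProduct h N ⊛ eulerProduct h N
      ≈⟨ mod-q^-weaken (ℕP.m≤n*m (suc N) h) (ModQ.~-⊛ (h ℕ.* suc N) stable stable) ⟨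
    eulerProduct h (N ℕ.+ N) ⊛ eulerProduct h (N ℕ.+ N)
      ≈⟨ mod-q^-weaken (ℕP.≤-trans (s≤s (ℕP.m≤m+n N N)) (ℕP.m≤n*m (suc (N ℕ.+ N)) h)) (eulerProduct²-double N) ⟩
    eulerProduct (2 ℕ.* h) N ⊛ Θ N
      ∎
    where
    open ModQ (suc N)
    open ~-Reasoning
    stable : eulerProduct h (N ℕ.+ N) ≈ eulerProduct h N mod-q^ (h ℕ.* suc N)
    stable = eulerProduct-stable h N N

module Truncation where

  open import Data.Nat as ℕ using (ℕ; zero; suc; _∸_; _≤_; s≤s)
  import Data.Nat.Properties as ℕP
  open import Data.Integer as ℤ using (ℤ; +_; _+_; _*_; -_)
  import Data.Integer.Properties as ℤP
  open import Data.Integer.Tactic.RingSolver using (solve-∀)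
  open import Data.Nat.Tactic.RingSolver using () renaming (solve-∀ to ℕ-solve)
  open import Data.List using (List; []; _∷_; _++_; applyUpTo; replicate)
  open import Relation.Binary.PropositionalEquality hiding ([_])
  open import Defs
  open PowerSeries
  open EulerProduct

  -- Defs.convCoeff, Defs.fTrunc and Defs.invList recurse through where-bound helpers that
  -- cannot be named. Each *-unique lemma characterises such a helper by its defining
  -- equations; in the with-clauses below, abstracting an index and its successor apart
  -- (and ℤ._+_, which would otherwise compute) makes the helper inferable by unification.

  convolution-unique : ∀ f g {G : ℕ → ℕ → ℤ} → (∀ n → G 0 n ≡ coeff f 0 * coeff g n) →
            (∀ k n → G (suc k) n ≡ G k n + coeff f (suc k) * coeff g (n ∸ suc k)) →
            ∀ k n → G k n ≡ Σ≤ k (λ i → coeff f i * coeff g (n ∸ i))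
  convolution-unique f g G₀ Gₛ zero    n = G₀ n
  convolution-unique f g {G} G₀ Gₛ (suc k) n =
    trans (Gₛ k n) (cong (_+ coeff f (suc k) * coeff g (n ∸ suc k)) (convolution-unique f g {G} G₀ Gₛ k n))

  convCoeff≡⊛ : ∀ f g n → convCoeff f g n ≡ (coeff f ⊛ coeff g) n
  convCoeff≡⊛ f g zero    = refl
  convCoeff≡⊛ f g (suc x) = trans (diagonal x) (sym (⊛-coeff (coeff f) (coeff g) (suc x)))
    where
    diagonal : ∀ x → convCoeff f g (suc x) ≡ Σ≤ (suc x) (λ i → coeff f i * coeff g (suc x ∸ i))
    diagonal x with convolution-unique f g (λ _ → refl) (λ _ _ → refl) | x | suc x
    ... | sum | X | P with ℤ._+_
    ... | plus = cong (λ z → plus z (coeff f P * coeff g (X ∸ X))) (sum X P)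

  productList : ℕ → ℕ → ℕ → List ℤ
  productList N h zero    = one N
  productList N h (suc k) = mul N (oneMinusQ^ N (h ℕ.* suc k)) (productList N h k)

  productList-unique : ∀ h {G : ℕ → ℕ → List ℤ} → (∀ N → G N 0 ≡ one N) →
                       (∀ N k → G N (suc k) ≡ mul N (oneMinusQ^ N (h ℕ.* suc k)) (G N k)) →
                       ∀ N k → G N k ≡ productList N h k
  productList-unique h G₀ Gₛ N zero    = G₀ N
  productList-unique h {G} G₀ Gₛ N (suc k) =
    trans (Gₛ N k) (cong (mul N (oneMinusQ^ N (h ℕ.* suc k))) (productList-unique h {G} G₀ Gₛ N k))

  fTrunc≡productList : ∀ N h → fTrunc N h ≡ productList N h N
  fTrunc≡productList zero    h = refl
  fTrunc≡productList (suc x) h with productList-unique h (λ _ → refl) (λ _ _ → refl) | x | suc x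
  ... | unique | X | P = cong (mul (suc X) (oneMinusQ^ (suc X) (h ℕ.* P))) (unique P X)

  inverseStep-unique : ∀ f {G : ℕ → ℕ → ℤ} → (∀ n → G n 0 ≡ coeff f (suc n) * coeff (invList f n) 0) →
    (∀ n k → G n (suc k) ≡ G n k + coeff f (suc n ∸ suc k) * coeff (invList f n) (suc k)) →
    ∀ n k → G n k ≡ inverseStep (coeff f) n (invList f n) k
  inverseStep-unique f G₀ Gₛ n zero    = G₀ n
  inverseStep-unique f {G} G₀ Gₛ n (suc k) =
    trans (Gₛ n k) (cong (_+ coeff f (suc n ∸ suc k) * coeff (invList f n) (suc k)) (inverseStep-unique f {G} G₀ Gₛ n k))

  invList-suc : ∀ f n → invList f (suc n) ≡ invList f n ++ (- inverseStep (coeff f) n (invList f n) n ∷ [])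
  invList-suc f zero    = refl
  invList-suc f (suc y) with inverseStep-unique f (λ _ → refl) (λ _ _ → refl) | y | suc y in eq | invList f (suc y) in eqL
  ... | unique | Y | P | L with trans (cong (invList f) (sym eq)) eqL
  ... | eq′ with ℤ.-_ | ℤ._+_
  ... | neg | plus = cong (λ z → L ++ (neg (plus z (coeff f (P ∸ Y) * coeff L P)) ∷ []))
                          (trans (unique P Y) (cong (λ L′ → inverseStep (coeff f) P L′ Y) eq′))

  invList≡inverseList : ∀ f n → invList f n ≡ inverseList (coeff f) n
  invList≡inverseList f zero    = refl
  invList≡inverseList f (suc n) =
    trans (invList-suc f n) (cong (λ L → L ++ (- inverseStep (coeff f) n L n ∷ [])) (invList≡inverseList f n))

  Agrees : ℕ → List ℤ → Series → Set
  Agrees N xs f = ∀ n → n ≤ N → coeff xs n ≡ f n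

  coeff-applyUpTo : ∀ N (a : ℕ → ℤ) {n} → n ≤ N → coeff (applyUpTo a (suc N)) n ≡ a n
  coeff-applyUpTo N       a {zero}  _         = refl
  coeff-applyUpTo (suc N) a {suc n} (s≤s n≤N) = coeff-applyUpTo N (λ i → a (suc i)) n≤N

  agrees-mul : ∀ {N xs ys f g} → Agrees N xs f → Agrees N ys g → Agrees N (mul N xs ys) (f ⊛ g)
  agrees-mul {N} {xs} {ys} {f} {g} xs≈f ys≈g n n≤N = begin
    coeff (mul N xs ys) n                             ≡⟨ coeff-applyUpTo N (convCoeff xs ys) n≤N ⟩
    convCoeff xs ys n                                 ≡⟨ convCoeff≡⊛ xs ys n ⟩
    (coeff xs ⊛ coeff ys) n                           ≡⟨ ⊛-coeff (coeff xs) (coeff ys) n ⟩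
    Σ≤ n (λ i → coeff xs i * coeff ys (n ∸ i))        ≡⟨ Σ≤-cong n (λ i i≤n → cong₂ _*_ (xs≈f i (ℕP.≤-trans i≤n n≤N))
                                                                                       (ys≈g (n ∸ i) (ℕP.≤-trans (ℕP.m∸n≤m n i) n≤N))) ⟩
    Σ≤ n (λ i → f i * g (n ∸ i))                      ≡⟨ ⊛-coeff f g n ⟨
    (f ⊛ g) n                                         ∎
    where open ≡-Reasoning

  agrees-one : ∀ N → Agrees N (one N) 1ₛ
  agrees-one N zero    _ = refl
  agrees-one N (suc n) n≤N = coeff-applyUpTo N (coeff (+ 1 ∷ [])) n≤N

  agrees-powN : ∀ {N xs f} e → Agrees N xs f → Agrees N (powN N xs e) (f ^ e)
  agrees-powN {N} zero    _    = agrees-one N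
  agrees-powN     (suc e) xs≈f = agrees-mul xs≈f (agrees-powN e xs≈f)

  agrees-oneMinusQ^ : ∀ N j → Agrees N (oneMinusQ^ N (suc j)) (1ₛ ⊖ q^ (suc j))
  agrees-oneMinusQ^ N j zero    n≤N = coeff-applyUpTo N (coeff (+ 1 ∷ replicate j (+ 0) ++ (- (+ 1) ∷ []))) n≤N
  agrees-oneMinusQ^ N j (suc n) n≤N =
    trans (coeff-applyUpTo N (coeff (+ 1 ∷ replicate j (+ 0) ++ (- (+ 1) ∷ []))) n≤N) (trans (padding j n) (sym (ℤP.+-identityˡ _)))
    where
    padding : ∀ j n → coeff (replicate j (+ 0) ++ (- (+ 1) ∷ [])) n ≡ - (q^ j) n
    padding zero    zero    = refl
    padding zero    (suc n) = refl
    padding (suc j) zero    = refl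
    padding (suc j) (suc n) = padding j n

  agrees-productList : ∀ N h k → Agrees N (productList N (suc h) k) (eulerProduct (suc h) k)
  agrees-productList N h zero    = agrees-one N
  agrees-productList N h (suc k) = agrees-mul (agrees-oneMinusQ^ N (k ℕ.+ h ℕ.* suc k)) (agrees-productList N h k)

  agrees-fTrunc : ∀ N h → Agrees N (fTrunc N (suc h)) (eulerProduct (suc h) N)
  agrees-fTrunc N h n n≤N = trans (cong (λ xs → coeff xs n) (fTrunc≡productList N (suc h))) (agrees-productList N h N n n≤N)

  inverseStep-local : ∀ a b n bs {k} → k ≤ n → (∀ i → i ≤ suc n → a i ≡ b i) → inverseStep a n bs k ≡ inverseStep b n bs k
  inverseStep-local a b n bs {zero}  _  a≈b = cong (_* coeff bs 0) (a≈b (suc n) ℕP.≤-refl)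
  inverseStep-local a b n bs {suc k} k< a≈b =
    cong₂ _+_ (inverseStep-local a b n bs (ℕP.<⇒≤ k<) a≈b) (cong (_* coeff bs (suc k)) (a≈b (suc n ∸ suc k) (ℕP.m∸n≤m (suc n) (suc k))))

  inverseList-local : ∀ a b n → (∀ i → i ≤ n → a i ≡ b i) → inverseList a n ≡ inverseList b n
  inverseList-local a b zero    a≈b = refl
  inverseList-local a b (suc n) a≈b =
    trans (cong (λ L → L ++ (- inverseStep a n L n ∷ [])) (inverseList-local a b n (λ i i≤n → a≈b i (ℕP.m≤n⇒m≤1+n i≤n))))
          (cong (λ z → inverseList b n ++ (- z ∷ [])) (inverseStep-local a b n (inverseList b n) ℕP.≤-refl a≈b))

  agrees-inv : ∀ {N xs f} → Agrees N xs f → Agrees N (inv N xs) (inverse f)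
  agrees-inv {N} {xs} {f} xs≈f n n≤N = begin
    coeff (invList xs N) n                  ≡⟨ cong (λ L → coeff L n) (invList≡inverseList xs N) ⟩
    coeff (inverseList (coeff xs) N) n      ≡⟨ inverseList-prefix (coeff xs) n≤N ⟩
    inverse (coeff xs) n                    ≡⟨ cong (λ L → coeff L n) (inverseList-local (coeff xs) f n (λ i i≤n → xs≈f i (ℕP.≤-trans i≤n n≤N))) ⟩
    inverse f n                             ∎
    where open ≡-Reasoning

  abar≡ : ∀ m N → abar (2 ℕ.* m ℕ.+ 2) N ≡
    (eulerProduct 4 N ^ (2 ℕ.* m ℕ.+ 1) ⊛ inverse (eulerProduct 1 N ^ 2 ⊛ eulerProduct 2 N ^ (4 ℕ.* m ℕ.+ 1))) N
  abar≡ m N =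
    trans (cong₂ coefficient (exponent₄ m) (exponent₂ m))
          (agrees-mul (agrees-powN (2 ℕ.* m ℕ.+ 1) (agrees-fTrunc N 3))
                      (agrees-inv (agrees-mul (agrees-powN 2 (agrees-fTrunc N 0)) (agrees-powN (4 ℕ.* m ℕ.+ 1) (agrees-fTrunc N 1))))
                      N ℕP.≤-refl)
    where
    coefficient : ℤ → ℤ → ℤ
    coefficient a b = coeff (mul N (powZ N (fTrunc N 4) a) (inv N (mul N (powN N (fTrunc N 1) 2) (powZ N (fTrunc N 2) b)))) N
    cancel : ∀ a k → + (a ℕ.+ k) ℤ.- + k ≡ + a
    cancel a k = trans (cong (ℤ._- + k) (ℤP.pos-+ a k)) (add-sub (+ a) (+ k))
      where
      add-sub : ∀ a k → a + k ℤ.- k ≡ a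
      add-sub = solve-∀
    exponent₄ : ∀ m → + (2 ℕ.* m ℕ.+ 2) ℤ.- + 1 ≡ + (2 ℕ.* m ℕ.+ 1)
    exponent₄ m = trans (cong (λ z → + z ℤ.- + 1) (shape m)) (cancel (2 ℕ.* m ℕ.+ 1) 1)
      where
      shape : ∀ m → 2 ℕ.* m ℕ.+ 2 ≡ 2 ℕ.* m ℕ.+ 1 ℕ.+ 1
      shape = ℕ-solve
    exponent₂ : ∀ m → + (2 ℕ.* (2 ℕ.* m ℕ.+ 2)) ℤ.- + 3 ≡ + (4 ℕ.* m ℕ.+ 1)
    exponent₂ m = trans (cong (λ z → + z ℤ.- + 3) (shape m)) (cancel (4 ℕ.* m ℕ.+ 1) 3)
      where
      shape : ∀ m → 2 ℕ.* (2 ℕ.* m ℕ.+ 2) ≡ 4 ℕ.* m ℕ.+ 1 ℕ.+ 3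
      shape = ℕ-solve

module Residues where

  open import Data.Nat as ℕ using (ℕ; zero; suc; _<_; _≡ᵇ_)
  import Data.Nat.Properties as ℕP
  open import Data.Nat.DivMod using (_%_; %-distribˡ-+; %-distribˡ-*; m%n<n)
  open import Data.Bool using (Bool; true; _∧_; _∨_; not)
  open import Data.Sum using (inj₁; inj₂)
  open import Relation.Binary.PropositionalEquality hiding ([_])
  open PowerSeries
  open Support

  Residues : Set
  Residues = ℕ → Bool

  mod8 : Residues → ℕ → Bool
  mod8 R n = R (n % 8)

  all< : ℕ → (ℕ → Bool) → Bool
  all< zero    p = true
  all< (suc n) p = all< n p ∧ p n

  all<-sound : ∀ n p → all< n p ≡ true → ∀ {a} → a < n → p a ≡ true
  all<-sound (suc n) p all {a} a<1+n with ℕP.m≤n⇒m<n∨m≡n (ℕP.≤-pred a<1+n)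
  ... | inj₁ a<n  = all<-sound n p (∧-true₁ all) a<n
    where
    ∧-true₁ : ∀ {x y} → (x ∧ y) ≡ true → x ≡ true
    ∧-true₁ {true} _ = refl
  ... | inj₂ refl = ∧-true₂ all
    where
    ∧-true₂ : ∀ {x y} → (x ∧ y) ≡ true → y ≡ true
    ∧-true₂ {true} {true} _ = refl

  infixr 4 _⇒ᵇ_
  _⇒ᵇ_ : Bool → Bool → Bool
  x ⇒ᵇ y = not x ∨ y

  ⇒ᵇ-mp : ∀ {x y} → (x ⇒ᵇ y) ≡ true → x ≡ true → y ≡ true
  ⇒ᵇ-mp {true} {true} _ _ = refl

  AddClosed : Residues → Residues → Residues → Bool
  AddClosed P Q R = all< 8 (λ a → all< 8 (λ b → P a ∧ Q b ⇒ᵇ R ((a ℕ.+ b) % 8)))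

  addClosed-sound : ∀ P Q R → AddClosed P Q R ≡ true →
                    ∀ i j → mod8 P i ≡ true → mod8 Q j ≡ true → mod8 R (i ℕ.+ j) ≡ true
  addClosed-sound P Q R closed i j i∈P j∈Q =
    subst (λ r → R r ≡ true) (sym (%-distribˡ-+ i j 8))
      (⇒ᵇ-mp (all<-sound 8 (λ b → P (i % 8) ∧ Q b ⇒ᵇ R ((i % 8 ℕ.+ b) % 8))
                (all<-sound 8 (λ a → all< 8 (λ b → P a ∧ Q b ⇒ᵇ R ((a ℕ.+ b) % 8))) closed (m%n<n i 8)) (m%n<n j 8))
             (both i∈P j∈Q))
    where
    both : ∀ {x y} → x ≡ true → y ≡ true → (x ∧ y) ≡ true
    both refl refl = refl

  supported-⊛-mod8 : ∀ {M} P Q R {f g} → AddClosed P Q R ≡ true →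
                     Supported M (mod8 P) f → Supported M (mod8 Q) g → Supported M (mod8 R) (f ⊛ g)
  supported-⊛-mod8 P Q R closed sf sg = supported-⊛ sf sg (addClosed-sound P Q R closed)

  _⊆ᵇ_ : Residues → Residues → Bool
  P ⊆ᵇ Q = all< 8 (λ r → P r ⇒ᵇ Q r)

  supported-mod8-⊆ : ∀ {M} P Q {f} → (P ⊆ᵇ Q) ≡ true → Supported M (mod8 P) f → Supported M (mod8 Q) f
  supported-mod8-⊆ P Q P⊆Q = supported-weaken (λ n → ⇒ᵇ-mp (all<-sound 8 (λ r → P r ⇒ᵇ Q r) P⊆Q (m%n<n n 8)))

  supported-^-mod8 : ∀ {M} R {f} e → AddClosed R R R ≡ true → R 0 ≡ true → Supported M (mod8 R) f → Supported M (mod8 R) (f ^ e)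
  supported-^-mod8 R zero    closed 0∈R sf = supported-cong q^0 (supported-q^-∈ 0 0∈R)
  supported-^-mod8 R (suc e) closed 0∈R sf = supported-⊛-mod8 R R R closed sf (supported-^-mod8 R e closed 0∈R sf)

  SquaresInto : ℕ → Residues → Residues → Bool
  SquaresInto h P Q = all< 8 (λ a → P a ⇒ᵇ Q ((h ℕ.* (a ℕ.* a)) % 8))

  squaresInto-sound : ∀ h P Q → SquaresInto h P Q ≡ true → ∀ k → mod8 P k ≡ true → mod8 Q (h ℕ.* (k ℕ.* k)) ≡ true
  squaresInto-sound h P Q squares k k∈P =
    subst (λ r → Q r ≡ true) (sym reduce) (⇒ᵇ-mp (all<-sound 8 (λ a → P a ⇒ᵇ Q ((h ℕ.* (a ℕ.* a)) % 8)) squares (m%n<n k 8)) k∈P)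
    where
    a : ℕ
    a = k % 8
    reduce : (h ℕ.* (k ℕ.* k)) % 8 ≡ (h ℕ.* (a ℕ.* a)) % 8
    reduce = begin
      (h ℕ.* (k ℕ.* k)) % 8                  ≡⟨ %-distribˡ-* h (k ℕ.* k) 8 ⟩
      ((h % 8) ℕ.* ((k ℕ.* k) % 8)) % 8      ≡⟨ cong (λ r → ((h % 8) ℕ.* r) % 8) (%-distribˡ-* k k 8) ⟩
      ((h % 8) ℕ.* ((a ℕ.* a) % 8)) % 8      ≡⟨ %-distribˡ-* h (a ℕ.* a) 8 ⟨
      (h ℕ.* (a ℕ.* a)) % 8                  ∎
      where open ≡-Reasoning

  even zeroTwo one oneThree : Residues
  even     r = (r ≡ᵇ 0) ∨ (r ≡ᵇ 2) ∨ (r ≡ᵇ 4) ∨ (r ≡ᵇ 6)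
  zeroTwo  r = (r ≡ᵇ 0) ∨ (r ≡ᵇ 2)
  one      r = r ≡ᵇ 1
  oneThree r = (r ≡ᵇ 1) ∨ (r ≡ᵇ 3)

module ThetaDissection where

  open import Data.Nat as ℕ using (ℕ; zero; suc)
  open import Data.Integer as ℤ using (ℤ; +_)
  import Data.Integer.Properties as ℤP
  open import Data.Integer.Divisibility.Signed using (0∣⇒≡0)
  open import Data.Bool using (true; false; not; if_then_else_)
  open import Relation.Binary.PropositionalEquality hiding ([_])
  open PowerSeries
  open Support
  open Residues

  module G₁ = Gauss 1
  module G₂ = Gauss 2

  θ₁-supported-even : ∀ {M} k → mod8 even k ≡ true → Supported M (mod8 even) (G₁.θ k)
  θ₁-supported-even k k-even =
    supported-sign⊛ k (supported-q^-∈ (1 ℕ.* (k ℕ.* k)) (squaresInto-sound 1 even even refl k k-even))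

  θ₁-supported-odd : ∀ {M} k → mod8 even k ≡ false → Supported M (mod8 one) (G₁.θ k)
  θ₁-supported-odd k k-odd =
    supported-sign⊛ k (supported-q^-∈ (1 ℕ.* (k ℕ.* k)) (squaresInto-sound 1 (λ r → not (even r)) one refl k (cong not k-odd)))

  θ₂-supported : ∀ {M} k → Supported M (mod8 zeroTwo) (G₂.θ k)
  θ₂-supported k =
    supported-sign⊛ k (supported-q^-∈ (2 ℕ.* (k ℕ.* k)) (squaresInto-sound 2 (λ _ → true) zeroTwo refl k refl))

  evenPart oddPart : ℕ → Series
  evenPart k = if mod8 even k then G₁.θ k else 0ₛ
  oddPart  k = if mod8 even k then 0ₛ else G₁.θ k

  θ₁-split : ∀ k → G₁.θ k ≈ evenPart k ⊕ oddPart k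
  θ₁-split k with mod8 even k
  ... | true  = ≈-sym (⊕-identityʳ (G₁.θ k) ≈-refl)
  ... | false = λ n → sym (ℤP.+-identityˡ (G₁.θ k n))

  evenPart-supported : ∀ {M} k → Supported M (mod8 even) (evenPart k)
  evenPart-supported k with mod8 even k in eq
  ... | true  = θ₁-supported-even k eq
  ... | false = supported-0ₛ

  oddPart-supported : ∀ {M} k → Supported M (mod8 one) (oddPart k)
  oddPart-supported k with mod8 even k in eq
  ... | true  = supported-0ₛ
  ... | false = θ₁-supported-odd k eq

  evenPart-suc-0 : ∀ k → evenPart (suc k) 0 ≡ + 0
  evenPart-suc-0 k with mod8 even (suc k)
  ... | true  = ℤP.*-zeroʳ (sign (suc k) 0)
  ... | false = refl

  Σˢ≤-at : ∀ k g n → (∀ i → g i n ≡ + 0) → Σˢ≤ k g n ≡ + 0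
  Σˢ≤-at zero    g n g≡0 = g≡0 0
  Σˢ≤-at (suc k) g n g≡0 = cong₂ ℤ._+_ (Σˢ≤-at k g n g≡0) (g≡0 (suc k))

  module Parts (N : ℕ) where

    E O : Series
    E = G₁.θ 0 ⊕ [ + 2 ] ⊛ Σˢ≤ N (λ k → evenPart (suc k))
    O = Σˢ≤ N (λ k → oddPart (suc k))

    Θ₁≈E⊕2O : G₁.Θ N ≈ E ⊕ [ + 2 ] ⊛ O
    Θ₁≈E⊕2O = ≈-trans (⊕-congˡ (G₁.θ 0) (⊛-congˡ [ + 2 ] (≈-trans (Σˢ≤-cong N (λ k _ → θ₁-split (suc k))) (Σˢ≤-⊕ N _ _))))
                      (regroup (G₁.θ 0) (Σˢ≤ N (λ k → evenPart (suc k))) O)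
      where
      regroup : ∀ t A B → t ⊕ [ + 2 ] ⊛ (A ⊕ B) ≈ (t ⊕ [ + 2 ] ⊛ A) ⊕ [ + 2 ] ⊛ B
      regroup = solve 3 (λ t A B → t :+ con (+ 2) :* (A :+ B) := (t :+ con (+ 2) :* A) :+ con (+ 2) :* B) ≈-refl

    E-supported : ∀ {M} → Supported M (mod8 even) E
    E-supported = supported-⊕ (θ₁-supported-even 0 refl)
                              (supported-[ + 2 ]⊛ (supported-Σˢ≤ N _ (λ k _ → evenPart-supported (suc k))))

    O-supported : ∀ {M} → Supported M (mod8 one) O
    O-supported = supported-Σˢ≤ N _ (λ k _ → oddPart-supported (suc k))

    Θ₂-supported : ∀ {M} → Supported M (mod8 zeroTwo) (G₂.Θ N)
    Θ₂-supported = supported-⊕ (θ₂-supported 0)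
                               (supported-[ + 2 ]⊛ (supported-Σˢ≤ N _ (λ k _ → θ₂-supported (suc k))))

    E-unit : E 0 ≡ + 1
    E-unit = cong (λ s → + 1 ℤ.+ + 2 ℤ.* s) (Σˢ≤-at N _ 0 evenPart-suc-0)

    O-zero : O 0 ≡ + 0
    O-zero = 0∣⇒≡0 (O-supported 0 refl)

    Θ₂-unit : G₂.Θ N 0 ≡ + 1
    Θ₂-unit = cong (λ s → + 1 ℤ.+ + 2 ℤ.* s) (Σˢ≤-at N _ 0 (λ k → ℤP.*-zeroʳ (sign (suc k) 0)))

    Θ₁-unit : G₁.Θ N 0 ≡ + 1
    Θ₁-unit = trans (Θ₁≈E⊕2O 0) (cong₂ (λ e o → e ℤ.+ + 2 ℤ.* o) E-unit O-zero)

    E≡1-mod-2 : E ≈ 1ₛ mod (+ 2)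
    E≡1-mod-2 = 1ₛ⊕2⊛-mod-2 _ (≈-trans (⊛-identityˡ _) q^0)

    Θ₂≡1-mod-2 : G₂.Θ N ≈ 1ₛ mod (+ 2)
    Θ₂≡1-mod-2 = 1ₛ⊕2⊛-mod-2 _ (≈-trans (⊛-identityˡ _) q^0)

module Overcubic (m N : ℕ) where

  open import Data.Nat as ℕ using (suc)
  import Data.Nat.Properties as ℕP
  open import Defs using (abar)
  open import Data.Nat.DivMod using (_%_)
  open import Data.Integer as ℤ using (ℤ; +_; _*_; -_)
  open import Data.Integer.Divisibility.Signed using (_∣_; divides; ∣m∣n⇒∣m+n; ∣m⇒∣-m)
  open import Data.Integer.Tactic.RingSolver using (solve-∀)
  open import Data.Nat.Tactic.RingSolver using () renaming (solve-∀ to ℕ-solve)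
  open import Data.Bool using (false)
  open import Data.Sum using (_⊎_; inj₁; inj₂)
  open import Relation.Binary.PropositionalEquality hiding ([_])
  open PowerSeries
  open Support
  open Residues
  open EulerProduct
  open ThetaDissection
  open Parts N

  Θ₁ Θ₂ P X V′ W : Series
  Θ₁ = G₁.Θ N
  Θ₂ = G₂.Θ N
  P  = Θ₂ ^ (2 ℕ.* m ℕ.+ 1)
  X  = P ⊛ Θ₁
  V′ = E ⊛ E ⊖ [ + 4 ] ⊛ (O ⊛ O)
  W  = inverse (P ⊛ V′)

  P-unit : P 0 ≡ + 1
  P-unit = ^-unit Θ₂ (2 ℕ.* m ℕ.+ 1) Θ₂-unit

  X-unit : X 0 ≡ + 1
  X-unit = cong₂ _*_ P-unit Θ₁-unit

  PV′-unit : (P ⊛ V′) 0 ≡ + 1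
  PV′-unit = cong₂ (λ p v → p * v) P-unit (cong₂ (λ e o → e * e ℤ.+ - (+ 4 * (o * o))) E-unit O-zero)

  -- Multiplying Θ₁ = E + 2O by its conjugate E - 2O leaves a series in even exponents only.
  inverse-X : inverse X ≈ E ⊛ W ⊖ [ + 2 ] ⊛ (O ⊛ W)
  inverse-X = ≈-trans (≈-sym (inverse-unique X ((E ⊖ [ + 2 ] ⊛ O) ⊛ W) X-unit X⊛D⊛W≈1)) (distribute E O W)
    where
    conjugate : ∀ P E O W → (P ⊛ (E ⊕ [ + 2 ] ⊛ O)) ⊛ ((E ⊖ [ + 2 ] ⊛ O) ⊛ W) ≈ (P ⊛ (E ⊛ E ⊖ [ + 4 ] ⊛ (O ⊛ O))) ⊛ W
    conjugate = solve 4 (λ P E O W → (P :* (E :+ con (+ 2) :* O)) :* ((E :- con (+ 2) :* O) :* W)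
                                   := (P :* (E :* E :- con (+ 4) :* (O :* O))) :* W) ≈-refl
    distribute : ∀ E O W → (E ⊖ [ + 2 ] ⊛ O) ⊛ W ≈ E ⊛ W ⊖ [ + 2 ] ⊛ (O ⊛ W)
    distribute = solve 3 (λ E O W → (E :- con (+ 2) :* O) :* W := E :* W :- con (+ 2) :* (O :* W)) ≈-refl
    X⊛D⊛W≈1 : X ⊛ ((E ⊖ [ + 2 ] ⊛ O) ⊛ W) ≈ 1ₛ
    X⊛D⊛W≈1 = begin
      (P ⊛ Θ₁) ⊛ ((E ⊖ [ + 2 ] ⊛ O) ⊛ W)               ≈⟨ ⊛-congʳ _ (⊛-congˡ P Θ₁≈E⊕2O) ⟩
      (P ⊛ (E ⊕ [ + 2 ] ⊛ O)) ⊛ ((E ⊖ [ + 2 ] ⊛ O) ⊛ W) ≈⟨ conjugate P E O W ⟩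
      (P ⊛ V′) ⊛ W                                      ≈⟨ ⊛-inverseʳ (P ⊛ V′) PV′-unit ⟩
      1ₛ                                                ∎
      where open ≈-Reasoning

  E⊛W-supported : ∀ {M} → Supported M (mod8 even) (E ⊛ W)
  E⊛W-supported = supported-⊛-mod8 even even even refl E-supported W-supported
    where
    V′-supported : ∀ {M} → Supported M (mod8 even) V′
    V′-supported = supported-⊕ (supported-⊛-mod8 even even even refl E-supported E-supported)
                               (supported-⊝ (supported-[ + 4 ]⊛ (supported-⊛-mod8 one one even refl O-supported O-supported)))
    P-supported : ∀ {M} → Supported M (mod8 even) P
    P-supported = supported-^-mod8 even (2 ℕ.* m ℕ.+ 1) refl refl (supported-mod8-⊆ zeroTwo even refl Θ₂-supported)
    W-supported : ∀ {M} → Supported M (mod8 even) W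
    W-supported = supported-inverse PV′-unit refl (supported-⊛-mod8 even even even refl P-supported V′-supported)
                                    (addClosed-sound even even even refl)

  W≡Θ₂-mod-4 : W ≈ Θ₂ mod (+ 4)
  W≡Θ₂-mod-4 = begin
    inverse (P ⊛ V′)   ≈⟨ ~-inverse PV′-unit Θ₂-unit PV′≡Θ₂ ⟩
    inverse Θ₂         ≈⟨ inverse-Θ₂ ⟩
    Θ₂                 ∎
    where
    open Mod (+ 4)
    open ~-Reasoning
    Θ₂²≡1 : Θ₂ ⊛ Θ₂ ≈ 1ₛ mod (+ 4)
    Θ₂²≡1 = square-mod-4 Θ₂≡1-mod-2
    P≡Θ₂ : P ≈ Θ₂ mod (+ 4)
    P≡Θ₂ = begin
      Θ₂ ^ (2 ℕ.* m ℕ.+ 1)             ≈⟨ ≈⇒~ (≈-trans (^-cong′ (odd m)) (^-+ Θ₂ (m ℕ.+ m) 1)) ⟩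
      Θ₂ ^ (m ℕ.+ m) ⊛ Θ₂ ^ 1          ≈⟨ ≈⇒~ (⊛-congʳ (Θ₂ ^ 1) (≈-trans (^-+ Θ₂ m m) (≈-sym (^-⊛ Θ₂ Θ₂ m)))) ⟩
      (Θ₂ ⊛ Θ₂) ^ m ⊛ Θ₂ ^ 1          ≈⟨ ~-⊛ʳ (Θ₂ ^ 1) (~-^ m Θ₂²≡1) ⟩
      1ₛ ^ m ⊛ Θ₂ ^ 1                  ≈⟨ ≈⇒~ (≈-trans (⊛-congʳ (Θ₂ ^ 1) (1ₛ^ m)) (≈-trans (⊛-identityˡ _) (⊛-identityʳ Θ₂))) ⟩
      Θ₂                               ∎
      where
      odd : ∀ m → 2 ℕ.* m ℕ.+ 1 ≡ m ℕ.+ m ℕ.+ 1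
      odd = ℕ-solve
      ^-cong′ : ∀ {a b} → a ≡ b → Θ₂ ^ a ≈ Θ₂ ^ b
      ^-cong′ refl = ≈-refl
    V′≡1 : V′ ≈ 1ₛ mod (+ 4)
    V′≡1 = begin
      E ⊛ E ⊖ [ + 4 ] ⊛ (O ⊛ O)    ≈⟨ ~-⊕ (square-mod-4 E≡1-mod-2) (~-⊝ ([ + 4 ]⊛-mod (O ⊛ O))) ⟩
      1ₛ ⊖ 0ₛ                      ≈⟨ ≈⇒~ (⊕-identityʳ 1ₛ ≈-refl) ⟩
      1ₛ                           ∎
    PV′≡Θ₂ : P ⊛ V′ ≈ Θ₂ mod (+ 4)
    PV′≡Θ₂ = ~-trans (~-⊛ P≡Θ₂ V′≡1) (≈⇒~ (⊛-identityʳ Θ₂))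
    inverse-Θ₂ : inverse Θ₂ ≈ Θ₂ mod (+ 4)
    inverse-Θ₂ = begin
      inverse Θ₂                  ≈⟨ ≈⇒~ (⊛-identityʳ (inverse Θ₂)) ⟨
      inverse Θ₂ ⊛ 1ₛ             ≈⟨ ~-⊛ˡ (inverse Θ₂) Θ₂²≡1 ⟨
      inverse Θ₂ ⊛ (Θ₂ ⊛ Θ₂)      ≈⟨ ≈⇒~ (≈-trans (≈-sym (⊛-assoc (inverse Θ₂) Θ₂ Θ₂))
                                               (≈-trans (⊛-congʳ Θ₂ (≈-trans (⊛-comm (inverse Θ₂) Θ₂) (⊛-inverseʳ Θ₂ Θ₂-unit))) (⊛-identityˡ Θ₂))) ⟩
      Θ₂                          ∎

  O⊛Θ₂-supported : ∀ {M} → Supported M (mod8 oneThree) (O ⊛ Θ₂)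
  O⊛Θ₂-supported = supported-⊛-mod8 one zeroTwo oneThree refl O-supported Θ₂-supported

  8∣inverse-X : N % 8 ≡ 5 ⊎ N % 8 ≡ 7 → + 8 ∣ inverse X N
  8∣inverse-X N≡5∨7 = subst (+ 8 ∣_) (sym (trans (inverse-X N) (cong (λ t → (E ⊛ W) N ℤ.+ - t) ([ + 2 ]-⊛-coeff (O ⊛ W) N))))
                        (∣m∣n⇒∣m+n (E⊛W-supported N (odd N≡5∨7)) (∣m⇒∣-m (double 4∣O⊛W)))
    where
    odd : N % 8 ≡ 5 ⊎ N % 8 ≡ 7 → even (N % 8) ≡ false
    odd (inj₁ eq) = cong even eq
    odd (inj₂ eq) = cong even eq
    outside : N % 8 ≡ 5 ⊎ N % 8 ≡ 7 → oneThree (N % 8) ≡ false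
    outside (inj₁ eq) = cong oneThree eq
    outside (inj₂ eq) = cong oneThree eq
    4∣O⊛W : + 4 ∣ (O ⊛ W) N
    4∣O⊛W = subst (+ 4 ∣_) (add-sub ((O ⊛ W) N) ((O ⊛ Θ₂) N))
              (∣m∣n⇒∣m+n (Mod.supported (Mod.~-⊛ˡ (+ 4) O W≡Θ₂-mod-4) N refl) (O⊛Θ₂-supported N (outside N≡5∨7)))
      where
      add-sub : ∀ a b → a ℤ.+ - b ℤ.+ b ≡ a
      add-sub = solve-∀
    double : ∀ {x} → + 4 ∣ x → + 8 ∣ + 2 * x
    double {x} (divides q x≡q*4) = divides q (trans (cong (+ 2 *_) x≡q*4) (regroup q))
      where
      regroup : ∀ q → + 2 * (q * + 4) ≡ q * + 8
      regroup = solve-∀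

  A B : Series
  A = eulerProduct 4 N ^ (2 ℕ.* m ℕ.+ 1)
  B = eulerProduct 1 N ^ 2 ⊛ eulerProduct 2 N ^ (4 ℕ.* m ℕ.+ 1)

  B≡A⊛X : B ≈ A ⊛ X mod-q^ (suc N)
  B≡A⊛X = begin
    f₁ ^ 2 ⊛ f₂ ^ (4 ℕ.* m ℕ.+ 1)           ≈⟨ ≈⇒~ (⊛-congʳ (f₂ ^ (4 ℕ.* m ℕ.+ 1)) (⊛-congˡ f₁ (⊛-identityʳ f₁))) ⟩
    (f₁ ⊛ f₁) ⊛ f₂ ^ (4 ℕ.* m ℕ.+ 1)        ≈⟨ ~-⊛ʳ (f₂ ^ (4 ℕ.* m ℕ.+ 1)) (G₁.eulerProduct² N) ⟩
    (f₂ ⊛ Θ₁) ⊛ f₂ ^ (4 ℕ.* m ℕ.+ 1)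
      ≈⟨ ≈⇒~ (≈-trans (swap f₂ Θ₁ _) (⊛-congʳ Θ₁ (≈-trans (^-cong′ (double m)) (≈-trans (^-+ f₂ e e) (≈-sym (^-⊛ f₂ f₂ e)))))) ⟩
    (f₂ ⊛ f₂) ^ e ⊛ Θ₁                      ≈⟨ ~-⊛ʳ Θ₁ (~-^ e (G₂.eulerProduct² N)) ⟩
    (f₄ ⊛ Θ₂) ^ e ⊛ Θ₁                      ≈⟨ ≈⇒~ (≈-trans (⊛-congʳ Θ₁ (^-⊛ f₄ Θ₂ e)) (⊛-assoc (f₄ ^ e) P Θ₁)) ⟩
    A ⊛ X                                   ∎
    where
    open ModQ (suc N)
    open ~-Reasoning
    f₁ f₂ f₄ : Series
    e : ℕ
    f₁ = eulerProduct 1 N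
    f₂ = eulerProduct 2 N
    f₄ = eulerProduct 4 N
    e = 2 ℕ.* m ℕ.+ 1
    double : ∀ m → suc (4 ℕ.* m ℕ.+ 1) ≡ (2 ℕ.* m ℕ.+ 1) ℕ.+ (2 ℕ.* m ℕ.+ 1)
    double = ℕ-solve
    ^-cong′ : ∀ {a b} → a ≡ b → f₂ ^ a ≈ f₂ ^ b
    ^-cong′ refl = ≈-refl
    swap : ∀ f t g → (f ⊛ t) ⊛ g ≈ (f ⊛ g) ⊛ t
    swap = solve 3 (λ f t g → (f :* t) :* g := (f :* g) :* t) ≈-refl

  A⊛inverse-B≡inverse-X : A ⊛ inverse B ≈ inverse X mod-q^ (suc N)
  A⊛inverse-B≡inverse-X = ModQ.⊛-inverse-~ (suc N) A-unit B-unit X-unit B≡A⊛X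
    where
    A-unit : A 0 ≡ + 1
    A-unit = ^-unit (eulerProduct 4 N) (2 ℕ.* m ℕ.+ 1) (eulerProduct-unit 3 N)
    B-unit : B 0 ≡ + 1
    B-unit = cong₂ _*_ (^-unit (eulerProduct 1 N) 2 (eulerProduct-unit 0 N))
                       (^-unit (eulerProduct 2 N) (4 ℕ.* m ℕ.+ 1) (eulerProduct-unit 1 N))

  8∣abar : N % 8 ≡ 5 ⊎ N % 8 ≡ 7 → + 8 ∣ abar (2 ℕ.* m ℕ.+ 2) N
  8∣abar N≡5∨7 = subst (+ 8 ∣_) (sym abar≡inverse-X) (8∣inverse-X N≡5∨7)
    where
    abar≡inverse-X : abar (2 ℕ.* m ℕ.+ 2) N ≡ inverse X N
    abar≡inverse-X = trans (Truncation.abar≡ m N) (mod-q^-coeff A⊛inverse-B≡inverse-X (ℕP.n<1+n N))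

open import Defs
open import Data.Nat using (_+_; _*_)
open import Data.Nat.DivMod using (_%_; [m+kn]%n≡m%n)
open import Data.Nat.Tactic.RingSolver using () renaming (solve-∀ to ℕ-solve)
open import Data.Integer using (+_)
open import Data.Integer.Divisibility using (_∣_)
import Data.Integer.Divisibility.Signed as Signed
open import Data.Product using (_×_; _,_)
open import Data.Sum using (inj₁; inj₂)
open import Relation.Binary.PropositionalEquality using (_≡_; trans; cong)

mainTheorem5 : (m n : ℕ) →
    (+ 8 ∣ abar (2 * m + 2) (8 * n + 5)) × (+ 8 ∣ abar (2 * m + 2) (8 * n + 7))
mainTheorem5 m n =
  Signed.∣⇒∣ᵤ (Overcubic.8∣abar m (8 * n + 5) (inj₁ (residue 5))) ,
  Signed.∣⇒∣ᵤ (Overcubic.8∣abar m (8 * n + 7) (inj₂ (residue 7)))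
  where
  residue : ∀ z → (8 * n + z) % 8 ≡ z % 8
  residue z = trans (cong (_% 8) (shape n z)) ([m+kn]%n≡m%n z n 8)
    where
    shape : ∀ n z → 8 * n + z ≡ z + n * 8
    shape = ℕ-solve
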